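{- Let $D\ge2$ be squarefree, $K=\mathbb{Q}(\sqrt D)$, and let $(\beta_j)_{j\in\mathbb{Z}}$ be the increasing enumeration of the indecomposable elements of $\mathcal{O}_K^+$ with $\beta_0=1$ (see context). For each $j\in\mathbb{Z}$ we have \[v_j\beta_j=\beta_{j-1}+\beta_{j+1},\] where $v_j=2$ if $\beta_{|j|}=\alpha_{i,r}$ with odd $i\ge-1$ and $1\le r\le u_{i+2}-1$, and $v_j=u_{i+1}+2$ if $\beta_{|j|}=\alpha_{i,0}$ with odd $i\ge -1$.
   Context: $D\ge2$ is squarefree, $K=\mathbb{Q}(\sqrt D)$, $\mathcal{O}_K$ its ring of integers, $x'$ the Galois conjugate of $x$. Let $\omega_D=\sqrt D$ if $D\equiv 2,3\pmod 4$ and $\omega_D=\frac{1+\sqrt D}{2}$ if $D\equiv1\pmod4$. $\alpha\in\mathcal{O}_K$ is totally positive if $\alpha>0,\alpha'>0$; $\mathcal{O}_K^+$ denotes the totally positive integers; $\alpha\in\mathcal{O}_K^+$ is indecomposable if it is not a sum of two elements of $\mathcal{O}_K^+$. Let $\sigma_D=\omega_D+\lfloor-\omega_D'\rfloor=[\overline{u_0,u_1,\dots,u_{s-1}}]$ (purely periodic continued fraction, $u_i$ positive integers), extended by $u_{i+s}=u_i$. Define $p_{ -1}=1,q_{ -1}=0,p_0=\lceil u_0/2\rceil,q_0=1$, $X_{i+2}=u_{i+2}X_{i+1}+X_i$ for $i\ge-1$ ($X\in\{p,q\}$), $\alpha_i=p_i-q_i\omega_D'$, $\alpha_{i,r}=\alpha_i+r\alpha_{i+1}$.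 The indecomposables of $\mathcal{O}_K^+$ are exactly the $\alpha_{i,r}$ (odd $i\ge-1$, $0\le r\le u_{i+2}-1$) and their conjugates; they form a bi-infinite strictly increasing sequence $\dots<\beta_{ -1}<\beta_0=1<\beta_1<\dots$, and $\beta_j'=\beta_{ -j}$; for $j\ge0$ the $\beta_j$ are the $\alpha_{i,r}$ in lexicographic order of $(i,r)$. -}

module Defs where

open import Data.Bool using (Bool; true; false; if_then_else_)
open import Data.Nat as ℕ using (ℕ; zero; suc)
open import Data.Nat.Divisibility using (_∣_)
import Data.Nat.DivMod as NDM
open import Data.Integer as ℤ using (ℤ; +_)
open import Data.Product using (_×_; _,_; proj₁; proj₂; ∃-syntax)
open import Data.Sum using (_⊎_)
open import Relation.Nullary using (¬_)
open import Relation.Binary.PropositionalEquality using (_≡_)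

SquareFree : ℕ → Set
SquareFree D = ∀ (p : ℕ) → p ℕ.* p ∣ D → p ≡ 1

-- division guarded against a zero divisor (never zero in our uses)
_div'_ : ℕ → ℕ → ℕ
m div' zero = 0
m div' suc k = m NDM./ suc k

isqrtGo : ℕ → ℕ → ℕ
isqrtGo D zero = zero
isqrtGo D (suc n) = if (suc n ℕ.* suc n) ℕ.≤ᵇ D then suc n else isqrtGo D n

isqrt : ℕ → ℕ
isqrt D = isqrtGo D D

oneMod4 : ℕ → Bool
oneMod4 D = (D NDM.% 4) ℕ.≡ᵇ 1

-- Elements of O_K, K = Q(√D), written a + b·ω_D with (a , b) ∈ ℤ × ℤ
-- (ω_D = √D if D ≡ 2,3 mod 4, ω_D = (1+√D)/2 if D ≡ 1 mod 4).

OK : Set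
OK = ℤ × ℤ

_⊕_ : OK → OK → OK
(a , b) ⊕ (c , d) = (a ℤ.+ c , b ℤ.+ d)

_⊖_ : OK → OK → OK
(a , b) ⊖ (c , d) = (a ℤ.- c , b ℤ.- d)

_·_ : ℤ → OK → OK
n · (a , b) = (n ℤ.* a , n ℤ.* b)

one : OK
one = (+ 1 , + 0)

-- Galois conjugate: ω' = -ω (D ≡ 2,3) resp. ω' = 1 - ω (D ≡ 1)
conj : ℕ → OK → OK
conj D (a , b) = if oneMod4 D then (a ℤ.+ b , ℤ.- b) else (a , ℤ.- b)

-- x + y√D > 0 (real number), for integers x, y and non-square D ≥ 2,
-- written out with integer arithmetic.
PosSqrt : ℕ → ℤ → ℤ → Set
PosSqrt D x y =
    (+ 0 ℤ.≤ x × + 0 ℤ.≤ y × ¬ (x ≡ + 0 × y ≡ + 0))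
  ⊎ ((+ 0 ℤ.< x × y ℤ.< + 0 × y ℤ.* y ℤ.* + D ℤ.< x ℤ.* x)
  ⊎ (x ℤ.< + 0 × + 0 ℤ.< y × x ℤ.* x ℤ.< y ℤ.* y ℤ.* + D))

-- α > 0 for the (fixed) real embedding in which √D > 0
Pos : ℕ → OK → Set
Pos D (a , b) = if oneMod4 D
  then PosSqrt D ((+ 2) ℤ.* a ℤ.+ b) b    -- 2(a + bω) = (2a+b) + b√D
  else PosSqrt D a b

_<[_]_ : OK → ℕ → OK → Set
α <[ D ] β = Pos D (β ⊖ α)

TotallyPositive : ℕ → OK → Set
TotallyPositive D α = Pos D α × Pos D (conj D α)

Indecomposable : ℕ → OK → Set
Indecomposable D α =
  TotallyPositive D α ×
  ¬ (∃[ β ] ∃[ γ ] (TotallyPositive D β × TotallyPositive D γ × α ≡ β ⊕ γ))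

-- Continued fraction of σ_D = ω_D + ⌊-ω_D'⌋ = [u_0, u_1, ...].
-- Complete quotients ξ_n = (P_n + √D)/Q_n; u_n = ⌊ξ_n⌋ = ⌊(P_n + ⌊√D⌋)/Q_n⌋,
-- P_{n+1} = u_n Q_n - P_n, Q_{n+1} = (D - P_{n+1}^2)/Q_n.
-- σ_D = ⌊√D⌋ + √D (D ≡ 2,3), σ_D = (2t+1+√D)/2 with t = ⌊(⌊√D⌋-1)/2⌋ (D ≡ 1).

cfStart : ℕ → ℕ × ℕ
cfStart D = if oneMod4 D
  then (suc (2 ℕ.* ((isqrt D ℕ.∸ 1) div' 2)) , 2)
  else (isqrt D , 1)

cfStep : ℕ → ℕ × ℕ → ℕ × ℕ
cfStep D (P , Q) =
  let a  = (P ℕ.+ isqrt D) div' Q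
      P' = a ℕ.* Q ℕ.∸ P
  in (P' , (D ℕ.∸ P' ℕ.* P') div' Q)

cfState : ℕ → ℕ → ℕ × ℕ
cfState D zero = cfStart D
cfState D (suc n) = cfStep D (cfState D n)

u : ℕ → ℕ → ℕ
u D n = let (P , Q) = cfState D n in (P ℕ.+ isqrt D) div' Q

-- p_i, q_i for i ≥ -1, stored with shifted index: pp D n = p_{n-1}, qq D n = q_{n-1}.
-- p_{-1}=1, q_{-1}=0, p_0=⌈u_0/2⌉, q_0=1, X_{i+2}=u_{i+2}X_{i+1}+X_i.

pq : ℕ → ℕ → ℕ × ℕ
pq D zero = (1 , 0)
pq D (suc zero) = ((suc (u D 0)) div' 2 , 1)
pq D (suc (suc n)) =
  let (p₁ , q₁) = pq D (suc n)
      (p₀ , q₀) = pq D n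
  in (u D (suc n) ℕ.* p₁ ℕ.+ p₀ , u D (suc n) ℕ.* q₁ ℕ.+ q₀)

-- alpha D n = α_{n-1} = p_{n-1} - q_{n-1} ω_D'  as an element a + bω
alpha : ℕ → ℕ → OK
alpha D n =
  let (p , q) = pq D n in
  if oneMod4 D then (+ p ℤ.- + q , + q) else (+ p , + q)

-- alphaR D k r = α_{i,r} = α_i + r α_{i+1} for the odd index i = 2k-1 ≥ -1
alphaR : ℕ → ℕ → ℕ → OK
alphaR D k r = alpha D (2 ℕ.* k) ⊕ ((+ r) · alpha D (suc (2 ℕ.* k)))

module Submission where

open import Defs
open import Data.Nat as ℕ using (ℕ)
open import Data.Integer as ℤ using (ℤ; +_; ∣_∣)
open import Data.Product using (_×_; ∃-syntax)
open import Relation.Binary.PropositionalEquality using (_≡_)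

open import Data.Bool using (Bool; true; false; if_then_else_; T)
open import Data.Unit using (tt)
open import Data.Empty using (⊥; ⊥-elim)
open import Data.Sum using (_⊎_; inj₁; inj₂)
open import Data.Product using (Σ; _,_; proj₁; proj₂)
open import Relation.Nullary using (¬_)
open import Relation.Binary.PropositionalEquality
  using (refl; sym; trans; cong; cong₂; subst; subst₂; _≢_; module ≡-Reasoning)
open import Data.Nat using (zero; suc; _≤ᵇ_)
open import Data.Nat.Divisibility using (divides)
import Data.Nat.DivMod as NDM
import Data.Nat.Properties as NP
open import Data.Integer using (-[1+_]; _+_; _*_; -_; _-_)
open import Data.Integer.Properties as ZP using (pos-*; pos-+)
open import Data.Integer.Tactic.RingSolver using (solve-∀)
open import Data.Nat.Induction using (<-rec)
import Data.Nat.Tactic.RingSolver as ℕSolver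

-- Sign bookkeeping on ℤ.  'NonNeg z' and 'Positive z' carry the natural
-- number witness, so that positivity proofs compose by pattern matching;
-- combinators prefixed 'nn' / 'pz' produce non-negativity / positivity.
module IntegerSign where

  NonNeg : ℤ → Set
  NonNeg z = Σ ℕ λ n → z ≡ + n

  Positive : ℤ → Set
  Positive z = Σ ℕ λ n → z ≡ + suc n

  nnN : ∀ n → NonNeg (+ n)
  nnN n = n , refl

  nn+ : ∀ {a b} → NonNeg a → NonNeg b → NonNeg (a + b)
  nn+ (m , refl) (n , refl) = m ℕ.+ n , refl

  nn* : ∀ {a b} → NonNeg a → NonNeg b → NonNeg (a * b)
  nn* (m , refl) (n , refl) = m ℕ.* n , sym (pos-* m n)

  pz+ : ∀ {a b} → Positive a → NonNeg b → Positive (a + b)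
  pz+ (m , refl) (n , refl) = m ℕ.+ n , refl

  pz+' : ∀ {a b} → NonNeg a → Positive b → Positive (a + b)
  pz+' {a} {b} p q = subst Positive (ZP.+-comm b a) (pz+ q p)

  pz* : ∀ {a b} → Positive a → Positive b → Positive (a * b)
  pz* (m , refl) (n , refl) = n ℕ.+ m ℕ.* suc n , refl

  pz⇒nn : ∀ {a} → Positive a → NonNeg a
  pz⇒nn (m , eq) = suc m , eq

  nnS : ∀ {a b} → a ≡ b → NonNeg a → NonNeg b
  nnS = subst NonNeg

  pzS : ∀ {a b} → a ≡ b → Positive a → Positive b
  pzS = subst Positive

  pz-1 : ∀ {x} → Positive x → NonNeg (x - + 1)
  pz-1 {x} (k , refl) = k , trans (cong (_- + 1) (cong +_ (NP.+-comm 1 k))) (lem (+ k))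
    where lem : ∀ x → x + + 1 - + 1 ≡ x
          lem = solve-∀

  nn-negpz : ∀ {a} → NonNeg a → Positive (- a) → ⊥
  nn-negpz (zero , refl) (k , ())
  nn-negpz (suc m , refl) (k , ())

  pz-negpz : ∀ {a} → Positive a → Positive (- a) → ⊥
  pz-negpz p = nn-negpz (pz⇒nn p)

  pz≢0 : ∀ {a} → Positive a → a ≡ + 0 → ⊥
  pz≢0 (m , refl) ()

  nn-neg-nn : ∀ {a} → NonNeg a → NonNeg (- a) → a ≡ + 0
  nn-neg-nn (zero , refl) _ = refl
  nn-neg-nn (suc m , refl) (k , ())

  nn-sum0 : ∀ {a b} → NonNeg a → NonNeg b → a + b ≡ + 0 → a ≡ + 0
  nn-sum0 (m , refl) (n , refl) eq = cong +_ (NP.m+n≡0⇒m≡0 m (ZP.+-injective eq))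

  trichotomy : ∀ z → Positive z ⊎ (z ≡ + 0 ⊎ Positive (- z))
  trichotomy (+ zero) = inj₂ (inj₁ refl)
  trichotomy (+ suc n) = inj₁ (n , refl)
  trichotomy -[1+ n ] = inj₂ (inj₂ (n , refl))

  nonNeg⊎neg : ∀ z → NonNeg z ⊎ Positive (- z)
  nonNeg⊎neg z with trichotomy z
  ... | inj₁ p = inj₁ (pz⇒nn p)
  ... | inj₂ (inj₁ e) = inj₁ (0 , e)
  ... | inj₂ (inj₂ p) = inj₂ p

  pos⊎nonPos : ∀ z → Positive z ⊎ NonNeg (- z)
  pos⊎nonPos z with trichotomy z
  ... | inj₁ p = inj₁ p
  ... | inj₂ (inj₁ refl) = inj₂ (0 , refl)
  ... | inj₂ (inj₂ p) = inj₂ (pz⇒nn p)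

  pzcancel : ∀ {x c} → Positive (x * c) → Positive c → NonNeg x
  pzcancel {x} {c} p q with nonNeg⊎neg x
  ... | inj₁ n = n
  ... | inj₂ n = ⊥-elim (nn-negpz (pz⇒nn p) (pzS (lem x c) (pz* n q)))
    where lem : ∀ x c → (- x) * c ≡ - (x * c)
          lem = solve-∀

  square-mono : ∀ {u v} → NonNeg u → Positive (- (u - v)) → Positive (v * v - u * u)
  square-mono {u} {v} nu p = pzS (sym (factor u v)) (pz* p' (pz+ (pz+ p' nu) nu))
    where
      neg-diff : ∀ u v → - (u - v) ≡ v - u
      neg-diff = solve-∀
      p' = pzS (neg-diff u v) p
      factor : ∀ u v → v * v - u * u ≡ (v - u) * ((v - u) + u + u)
      factor = solve-∀

  private
    swap-squares : ∀ u v → - (v * v - u * u) ≡ u * u - v * v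
    swap-squares = solve-∀

  squares-nonNeg : ∀ {u v} → NonNeg u → NonNeg v → NonNeg (u * u - v * v) → NonNeg (u - v)
  squares-nonNeg {u} {v} nu nv h with trichotomy (u - v)
  ... | inj₁ p = pz⇒nn p
  ... | inj₂ (inj₁ e) = 0 , e
  ... | inj₂ (inj₂ p) = ⊥-elim (nn-negpz h (pzS (sym (swap-squares v u)) (square-mono nu p)))

  squares-pos : ∀ {u v} → NonNeg u → NonNeg v → Positive (u * u - v * v) → Positive (u - v)
  squares-pos {u} {v} nu nv h with trichotomy (u - v)
  ... | inj₁ p = p
  ... | inj₂ (inj₁ e) = ⊥-elim (pz≢0 h (trans (factor u v) (cong (_* (u + v)) e)))
    where factor : ∀ u v → u * u - v * v ≡ (u - v) * (u + v)
          factor = solve-∀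
  ... | inj₂ (inj₂ p) = ⊥-elim (pz-negpz h (pzS (sym (swap-squares v u)) (square-mono nu p)))

  module SurdEstimates (d : ℤ) (nd : NonNeg d) where
    private
      m1 : ∀ d a b c e → (d * c * e) * (d * c * e) - (a * b) * (a * b)
           ≡ (d * c * c - a * a) * (d * e * e) + (a * a) * (d * e * e - b * b)
      m1 = solve-∀
      m2 : ∀ d a b c e → (a * b) * (a * b) - (d * c * e) * (d * c * e)
           ≡ (a * a - d * c * c) * (b * b) + (d * c * c) * (b * b - d * e * e)
      m2 = solve-∀
      m3 : ∀ d a b c e → d * (c + e) * (c + e) - (a + b) * (a + b)
           ≡ (d * c * c - a * a) + ((d * e * e - b * b) + (d * c * e - a * b) + (d * c * e - a * b))
      m3 = solve-∀
      m4 : ∀ d a b c e → (a + b) * (a + b) - d * (c + e) * (c + e)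
           ≡ (a * a - d * c * c) + ((b * b - d * e * e) + (a * b - d * c * e) + (a * b - d * c * e))
      m4 = solve-∀

    cross-below : ∀ {a b c e} → NonNeg a → NonNeg b → NonNeg c → NonNeg e →
      NonNeg (d * c * c - a * a) → NonNeg (d * e * e - b * b) → NonNeg (d * c * e - a * b)
    cross-below {a} {b} {c} {e} na nb nc ne h1 h2 =
      squares-nonNeg (nn* (nn* nd nc) ne) (nn* na nb)
        (nnS (sym (m1 d a b c e)) (nn+ (nn* h1 (nn* (nn* nd ne) ne)) (nn* (nn* na na) h2)))

    cross-above : ∀ {a b c e} → NonNeg a → NonNeg b → NonNeg c → NonNeg e →
      NonNeg (a * a - d * c * c) → NonNeg (b * b - d * e * e) → NonNeg (a * b - d * c * e)
    cross-above {a} {b} {c} {e} na nb nc ne h1 h2 =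
      squares-nonNeg (nn* na nb) (nn* (nn* nd nc) ne)
        (nnS (sym (m2 d a b c e)) (nn+ (nn* h1 (nn* nb nb)) (nn* (nn* (nn* nd nc) nc) h2)))

    sum-below : ∀ {a b c e} → NonNeg a → NonNeg b → NonNeg c → NonNeg e →
      Positive (d * c * c - a * a) → NonNeg (d * e * e - b * b) →
      Positive (d * (c + e) * (c + e) - (a + b) * (a + b))
    sum-below {a} {b} {c} {e} na nb nc ne h1 h2 =
      pzS (sym (m3 d a b c e)) (pz+ h1 (nn+ (nn+ h2 mx) mx))
      where mx = cross-below na nb nc ne (pz⇒nn h1) h2

    sum-above : ∀ {a b c e} → NonNeg a → NonNeg b → NonNeg c → NonNeg e →
      Positive (a * a - d * c * c) → NonNeg (b * b - d * e * e) →
      Positive ((a + b) * (a + b) - d * (c + e) * (c + e))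
    sum-above {a} {b} {c} {e} na nb nc ne h1 h2 =
      pzS (sym (m4 d a b c e)) (pz+ h1 (nn+ (nn+ h2 mx) mx))
      where mx = cross-above na nb nc ne (pz⇒nn h1) h2

  ∸-pos : ∀ {m n} → n ℕ.≤ m → + (m ℕ.∸ n) ≡ + m - + n
  ∸-pos {m} {n} le = trans (lem (+ (m ℕ.∸ n)) (+ n)) (cong (_- + n) (cong +_ (NP.m∸n+n≡m le)))
    where lem : ∀ x y → x ≡ (x + y) - y
          lem = solve-∀

  leNN : ∀ {m n} → m ℕ.≤ n → NonNeg (+ n - + m)
  leNN {m} {n} le = (n ℕ.∸ m) , sym (∸-pos le)

  ltPZ : ∀ {m n} → m ℕ.< n → Positive (+ n - + m)
  ltPZ {m} {n} lt with leNN lt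
  ... | k , e = k , trans (lem (+ n) (+ m)) (trans (cong (_+ + 1) e) (cong +_ (NP.+-comm k 1)))
    where lem : ∀ n m → n - m ≡ (n - (+ 1 + m)) + + 1
          lem = solve-∀

  pzLt : ∀ {m n} → Positive (+ n - + m) → m ℕ.< n
  pzLt {m} {n} (k , e) = subst (m ℕ.<_) eqn (NP.m<m+n m (ℕ.s≤s ℕ.z≤n))
    where eqn : m ℕ.+ suc k ≡ n
          eqn = ZP.+-injective (trans (cong (λ t → + m + t) (sym e)) (lem (+ m) (+ n)))
            where lem : ∀ x y → x + (y - x) ≡ y
                  lem = solve-∀

open IntegerSign

module SurdSign (d : ℤ) (nd : NonNeg d) where
  open SurdEstimates d nd

  BothNonNeg RationalDominant SurdDominant PosSurd : ℤ → ℤ → Set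
  BothNonNeg x y = NonNeg x × NonNeg y × ¬ (x ≡ + 0 × y ≡ + 0)
  RationalDominant x y = Positive x × Positive (- y) × Positive (x * x - y * y * d)
  SurdDominant x y = Positive (- x) × Positive y × Positive (y * y * d - x * x)
  -- x + y√d > 0
  PosSurd x y = BothNonNeg x y ⊎ (RationalDominant x y ⊎ SurdDominant x y)

  private
    nonPos-or-zero : ∀ {z w} → - z ≡ w → (z ≡ + 0 ⊎ Positive (- z)) → NonNeg w
    nonPos-or-zero eq (inj₁ e) = 0 , trans (sym eq) (cong -_ e)
    nonPos-or-zero eq (inj₂ n) = nnS eq (pz⇒nn n)

  -- The only delicate case of additivity: a positive number whose rational
  -- part dominates plus one whose surd part dominates.
  module _ {x1 y1 x2 y2 : ℤ} (h₁ : RationalDominant x1 y1) (h₂ : SurdDominant x2 y2) where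
    private
      px1 = proj₁ h₁
      py1 = proj₁ (proj₂ h₁)
      pn1 = proj₂ (proj₂ h₁)
      px2 = proj₁ h₂
      py2 = proj₁ (proj₂ h₂)
      pn2 = proj₂ (proj₂ h₂)

      -- Both parts of the sum cannot be ≤ 0: the two norm gaps would cancel.
      not-both-nonPos : NonNeg (- (x1 + x2)) → NonNeg (- (y1 + y2)) → ⊥
      not-both-nonPos hx hy =
        pz≢0 (pzS (identity x1 x2 y1 y2 d) (pz+ pn1 (pz⇒nn (pz+ pn2 (nn+ t1 t2))))) refl
        where
          identity : ∀ x1 x2 y1 y2 d → (x1 * x1 - y1 * y1 * d) + ((y2 * y2 * d - x2 * x2)
              + ((((- x2) - x1) * ((- x2) + x1)) + d * (((- y1) - y2) * ((- y1) + y2)))) ≡ + 0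
          identity = solve-∀
          neg-sum : ∀ a b → - (a + b) ≡ (- b) - a
          neg-sum = solve-∀
          neg-sum' : ∀ a b → - (a + b) ≡ (- a) - b
          neg-sum' = solve-∀
          t1 = nn* (nnS (neg-sum x1 x2) hx) (nn+ (pz⇒nn px2) (pz⇒nn px1))
          t2 = nn* nd (nn* (nnS (neg-sum' y1 y2) hy) (nn+ (pz⇒nn py1) (pz⇒nn py2)))

      sum-nonzero : ¬ (x1 + x2 ≡ + 0 × y1 + y2 ≡ + 0)
      sum-nonzero (ex , ey) = pz-negpz pn1 (pzS (norm-negates ex ey) pn2)
        where
          cancel : ∀ a b → a + b ≡ + 0 → b ≡ - a
          cancel a b e = trans (lem a b) (trans (cong (λ t → - a + t) e) (ZP.+-identityʳ (- a)))
            where lem : ∀ a b → b ≡ - a + (a + b)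
                  lem = solve-∀
          flip : ∀ x1 y1 d → (- y1) * (- y1) * d - (- x1) * (- x1) ≡ - (x1 * x1 - y1 * y1 * d)
          flip = solve-∀
          norm-negates : x1 + x2 ≡ + 0 → y1 + y2 ≡ + 0 → y2 * y2 * d - x2 * x2 ≡ - (x1 * x1 - y1 * y1 * d)
          norm-negates ex ey =
            trans (cong₂ (λ a b → b * b * d - a * a) (cancel x1 x2 ex) (cancel y1 y2 ey)) (flip x1 y1 d)

      -- x1 + x2 > 0 > y1 + y2: the rational part of the sum still dominates,
      -- otherwise x1 = (x1 + x2) - x2 would be dominated by its surd part.
      rational-wins : Positive (x1 + x2) → Positive (- (y1 + y2)) → PosSurd (x1 + x2) (y1 + y2)
      rational-wins p q with trichotomy ((x1 + x2) * (x1 + x2) - (y1 + y2) * (y1 + y2) * d)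
      ... | inj₁ r = inj₂ (inj₁ (p , q , r))
      ... | inj₂ r = ⊥-elim (pz-negpz pn1 (pzS (sym (flip x1 y1 d)) (pzS (recombine x1 x2 y1 y2 d) sq)))
        where
          recombine : ∀ x1 x2 y1 y2 d → d * (y2 + (- (y1 + y2))) * (y2 + (- (y1 + y2)))
              - ((- x2) + (x1 + x2)) * ((- x2) + (x1 + x2)) ≡ d * y1 * y1 - x1 * x1
          recombine = solve-∀
          negate : ∀ x1 x2 y1 y2 d → - ((x1 + x2) * (x1 + x2) - (y1 + y2) * (y1 + y2) * d)
              ≡ d * (- (y1 + y2)) * (- (y1 + y2)) - (x1 + x2) * (x1 + x2)
          negate = solve-∀
          flip : ∀ x1 y1 d → - (x1 * x1 - y1 * y1 * d) ≡ d * y1 * y1 - x1 * x1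
          flip = solve-∀
          reorder : ∀ x2 y2 d → y2 * y2 * d - x2 * x2 ≡ d * y2 * y2 - (- x2) * (- x2)
          reorder = solve-∀
          sq = sum-below (pz⇒nn px2) (pz⇒nn p) (pz⇒nn py2) (pz⇒nn q) (pzS (reorder x2 y2 d) pn2)
                 (nonPos-or-zero (negate x1 x2 y1 y2 d) r)

      surd-wins : Positive (- (x1 + x2)) → Positive (y1 + y2) → PosSurd (x1 + x2) (y1 + y2)
      surd-wins p q with trichotomy ((y1 + y2) * (y1 + y2) * d - (x1 + x2) * (x1 + x2))
      ... | inj₁ r = inj₂ (inj₂ (p , q , r))
      ... | inj₂ r = ⊥-elim (pz-negpz pn2 (pzS (sym (flip x2 y2 d)) (pzS (recombine x1 x2 y1 y2 d) sq)))
        where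
          recombine : ∀ x1 x2 y1 y2 d → (x1 + (- (x1 + x2))) * (x1 + (- (x1 + x2)))
              - d * ((- y1) + (y1 + y2)) * ((- y1) + (y1 + y2)) ≡ x2 * x2 - y2 * y2 * d
          recombine = solve-∀
          negate : ∀ x1 x2 y1 y2 d → - ((y1 + y2) * (y1 + y2) * d - (x1 + x2) * (x1 + x2))
              ≡ (- (x1 + x2)) * (- (x1 + x2)) - d * (y1 + y2) * (y1 + y2)
          negate = solve-∀
          flip : ∀ x2 y2 d → - (y2 * y2 * d - x2 * x2) ≡ x2 * x2 - y2 * y2 * d
          flip = solve-∀
          reorder : ∀ x1 y1 d → x1 * x1 - y1 * y1 * d ≡ x1 * x1 - d * (- y1) * (- y1)
          reorder = solve-∀
          sq = sum-above (pz⇒nn px1) (pz⇒nn p) (pz⇒nn py1) (pz⇒nn q) (pzS (reorder x1 y1 d) pn1)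
                 (nonPos-or-zero (negate x1 x2 y1 y2 d) r)

      by-signs : Positive (x1 + x2) ⊎ (x1 + x2 ≡ + 0 ⊎ Positive (- (x1 + x2))) →
                 Positive (y1 + y2) ⊎ (y1 + y2 ≡ + 0 ⊎ Positive (- (y1 + y2))) →
                 PosSurd (x1 + x2) (y1 + y2)
      by-signs (inj₁ p) (inj₁ q) = inj₁ (pz⇒nn p , pz⇒nn q , sum-nonzero)
      by-signs (inj₁ p) (inj₂ (inj₁ q)) = inj₁ (pz⇒nn p , (0 , q) , sum-nonzero)
      by-signs (inj₂ (inj₁ p)) (inj₁ q) = inj₁ ((0 , p) , pz⇒nn q , sum-nonzero)
      by-signs (inj₁ p) (inj₂ (inj₂ q)) = rational-wins p q
      by-signs (inj₂ (inj₂ p)) (inj₁ q) = surd-wins p q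
      by-signs (inj₂ (inj₁ p)) (inj₂ (inj₁ q)) = ⊥-elim (sum-nonzero (p , q))
      by-signs (inj₂ (inj₁ p)) (inj₂ (inj₂ q)) = ⊥-elim (not-both-nonPos (0 , cong -_ p) (pz⇒nn q))
      by-signs (inj₂ (inj₂ p)) (inj₂ (inj₁ q)) = ⊥-elim (not-both-nonPos (pz⇒nn p) (0 , cong -_ q))
      by-signs (inj₂ (inj₂ p)) (inj₂ (inj₂ q)) = ⊥-elim (not-both-nonPos (pz⇒nn p) (pz⇒nn q))

    add23 : PosSurd (x1 + x2) (y1 + y2)
    add23 = by-signs (trichotomy (x1 + x2)) (trichotomy (y1 + y2))

  private
    expand-sum : ∀ x1 x2 y1 y2 d → (x1 + x2) * (x1 + x2) - (y1 + y2) * (y1 + y2) * d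
        ≡ (x2 * x2 - y2 * y2 * d) + (x1 * (x1 + x2 + x2) + d * (y1 * ((- y2) + (- (y1 + y2)))))
    expand-sum = solve-∀
    expand-sum' : ∀ x1 x2 y1 y2 d → (y1 + y2) * (y1 + y2) * d - (x1 + x2) * (x1 + x2)
        ≡ (y2 * y2 * d - x2 * x2) + (d * (y1 * (y1 + y2 + y2)) + x1 * ((- x2) + (- (x1 + x2))))
    expand-sum' = solve-∀
    reorder : ∀ x y d → x * x - y * y * d ≡ x * x - d * (- y) * (- y)
    reorder = solve-∀
    reorder' : ∀ x y d → y * y * d - x * x ≡ d * y * y - (- x) * (- x)
    reorder' = solve-∀
    negate-sum : ∀ x1 x2 y1 y2 d → (x1 + x2) * (x1 + x2) - d * ((- y1) + (- y2)) * ((- y1) + (- y2))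
        ≡ (x1 + x2) * (x1 + x2) - (y1 + y2) * (y1 + y2) * d
    negate-sum = solve-∀
    negate-sum' : ∀ x1 x2 y1 y2 d → d * (y1 + y2) * (y1 + y2) - ((- x1) + (- x2)) * ((- x1) + (- x2))
        ≡ (y1 + y2) * (y1 + y2) * d - (x1 + x2) * (x1 + x2)
    negate-sum' = solve-∀
    neg-+ : ∀ a b → - (a + b) ≡ (- a) + (- b)
    neg-+ = solve-∀

  add11 : ∀ {x1 y1 x2 y2} → BothNonNeg x1 y1 → BothNonNeg x2 y2 → PosSurd (x1 + x2) (y1 + y2)
  add11 (nx1 , ny1 , nz) (nx2 , ny2 , _) =
    inj₁ (nn+ nx1 nx2 , nn+ ny1 ny2 , λ { (ex , ey) → nz (nn-sum0 nx1 nx2 ex , nn-sum0 ny1 ny2 ey) })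

  add12 : ∀ {x1 y1 x2 y2} → BothNonNeg x1 y1 → RationalDominant x2 y2 → PosSurd (x1 + x2) (y1 + y2)
  add12 {x1} {y1} {x2} {y2} (nx1 , ny1 , nz) (px2 , py2 , pn2) with nonNeg⊎neg (y1 + y2)
  ... | inj₁ ny = inj₁ (pz⇒nn px , ny , λ { (e , _) → pz≢0 px e })
    where px = pz+' nx1 px2
  ... | inj₂ py = inj₂ (inj₁ (px , py , pzS (sym (expand-sum x1 x2 y1 y2 d)) (pz+ pn2 (nn+ t1 t2))))
    where px = pz+' nx1 px2
          t1 = nn* nx1 (nn+ (nn+ nx1 (pz⇒nn px2)) (pz⇒nn px2))
          t2 = nn* nd (nn* ny1 (nn+ (pz⇒nn py2) (pz⇒nn py)))

  add13 : ∀ {x1 y1 x2 y2} → BothNonNeg x1 y1 → SurdDominant x2 y2 → PosSurd (x1 + x2) (y1 + y2)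
  add13 {x1} {y1} {x2} {y2} (nx1 , ny1 , nz) (px2 , py2 , pn2) with nonNeg⊎neg (x1 + x2)
  ... | inj₁ nx = inj₁ (nx , pz⇒nn py , λ { (_ , e) → pz≢0 py e })
    where py = pz+' ny1 py2
  ... | inj₂ px = inj₂ (inj₂ (px , py , pzS (sym (expand-sum' x1 x2 y1 y2 d)) (pz+ pn2 (nn+ t1 t2))))
    where py = pz+' ny1 py2
          t1 = nn* nd (nn* ny1 (nn+ (nn+ ny1 (pz⇒nn py2)) (pz⇒nn py2)))
          t2 = nn* nx1 (nn+ (pz⇒nn px2) (pz⇒nn px))

  add22 : ∀ {x1 y1 x2 y2} → RationalDominant x1 y1 → RationalDominant x2 y2 → PosSurd (x1 + x2) (y1 + y2)
  add22 {x1} {y1} {x2} {y2} (px1 , py1 , pn1) (px2 , py2 , pn2) =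
    inj₂ (inj₁ (pz+ px1 (pz⇒nn px2) , pzS (sym (neg-+ y1 y2)) (pz+ py1 (pz⇒nn py2)) ,
      pzS (negate-sum x1 x2 y1 y2 d) (sum-above (pz⇒nn px1) (pz⇒nn px2) (pz⇒nn py1) (pz⇒nn py2)
        (pzS (reorder x1 y1 d) pn1) (pz⇒nn (pzS (reorder x2 y2 d) pn2)))))

  add33 : ∀ {x1 y1 x2 y2} → SurdDominant x1 y1 → SurdDominant x2 y2 → PosSurd (x1 + x2) (y1 + y2)
  add33 {x1} {y1} {x2} {y2} (px1 , py1 , pn1) (px2 , py2 , pn2) =
    inj₂ (inj₂ (pzS (sym (neg-+ x1 x2)) (pz+ px1 (pz⇒nn px2)) , pz+ py1 (pz⇒nn py2) ,
      pzS (negate-sum' x1 x2 y1 y2 d) (sum-below (pz⇒nn px1) (pz⇒nn px2) (pz⇒nn py1) (pz⇒nn py2)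
        (pzS (reorder' x1 y1 d) pn1) (pz⇒nn (pzS (reorder' x2 y2 d) pn2)))))

  pr-add : ∀ {x1 y1 x2 y2} → PosSurd x1 y1 → PosSurd x2 y2 → PosSurd (x1 + x2) (y1 + y2)
  pr-add (inj₁ a) (inj₁ b) = add11 a b
  pr-add (inj₁ a) (inj₂ (inj₁ b)) = add12 a b
  pr-add (inj₁ a) (inj₂ (inj₂ b)) = add13 a b
  pr-add (inj₂ (inj₁ a)) (inj₂ (inj₁ b)) = add22 a b
  pr-add (inj₂ (inj₁ a)) (inj₂ (inj₂ b)) = add23 a b
  pr-add (inj₂ (inj₂ a)) (inj₂ (inj₂ b)) = add33 a b
  pr-add {x1} {y1} {x2} {y2} (inj₂ (inj₁ a)) (inj₁ b) = swap (add12 b a)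
    where swap = subst₂ PosSurd (ZP.+-comm x2 x1) (ZP.+-comm y2 y1)
  pr-add {x1} {y1} {x2} {y2} (inj₂ (inj₂ a)) (inj₁ b) = swap (add13 b a)
    where swap = subst₂ PosSurd (ZP.+-comm x2 x1) (ZP.+-comm y2 y1)
  pr-add {x1} {y1} {x2} {y2} (inj₂ (inj₂ a)) (inj₂ (inj₁ b)) = swap (add23 b a)
    where swap = subst₂ PosSurd (ZP.+-comm x2 x1) (ZP.+-comm y2 y1)

  private
    flip-norm : ∀ x y d → (- y) * (- y) * d - (- x) * (- x) ≡ - (x * x - y * y * d)
    flip-norm = solve-∀
    flip-norm' : ∀ x y d → (- x) * (- x) - (- y) * (- y) * d ≡ - (y * y * d - x * x)
    flip-norm' = solve-∀
    neg-neg : ∀ x → x ≡ - (- x)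
    neg-neg x = sym (ZP.neg-involutive x)

  pr-asym : ∀ {x y} → PosSurd x y → PosSurd (- x) (- y) → ⊥
  pr-asym (inj₁ (nx , ny , nz)) (inj₁ (nx' , ny' , _)) = nz (nn-neg-nn nx nx' , nn-neg-nn ny ny')
  pr-asym (inj₁ (nx , ny , nz)) (inj₂ (inj₁ (px' , _ , _))) = nn-negpz nx px'
  pr-asym (inj₁ (nx , ny , nz)) (inj₂ (inj₂ (_ , py' , _))) = nn-negpz ny py'
  pr-asym {x} (inj₂ (inj₁ (px , py , pn))) (inj₁ (nx' , _ , _)) = nn-negpz nx' (pzS (neg-neg x) px)
  pr-asym (inj₂ (inj₁ (px , py , pn))) (inj₂ (inj₁ (px' , _ , _))) = pz-negpz px px'
  pr-asym {x} {y} (inj₂ (inj₁ (px , py , pn))) (inj₂ (inj₂ (_ , _ , pn'))) = pz-negpz pn (pzS (flip-norm x y d) pn')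
  pr-asym {x} {y} (inj₂ (inj₂ (px , py , pn))) (inj₁ (_ , ny' , _)) = nn-negpz ny' (pzS (neg-neg y) py)
  pr-asym {x} {y} (inj₂ (inj₂ (px , py , pn))) (inj₂ (inj₁ (_ , _ , pn'))) = pz-negpz pn (pzS (flip-norm' x y d) pn')
  pr-asym (inj₂ (inj₂ (px , py , pn))) (inj₂ (inj₂ (_ , py' , _))) = pz-negpz py py'

  module Trichotomy (irrational : ∀ x y → x * x ≡ y * y * d → y ≡ + 0) where
    private
      from-diff : ∀ {a b} → a - b ≡ + 0 → a ≡ b
      from-diff {a} {b} e = trans (lem a b) (trans (cong (_+ b) e) (ZP.+-identityˡ b))
        where lem : ∀ a b → a ≡ (a - b) + b
              lem = solve-∀
      flip-norm'' : ∀ x y d → - (x * x - y * y * d) ≡ (- y) * (- y) * d - (- x) * (- x)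
      flip-norm'' = solve-∀
      flip-norm''' : ∀ x y d → - (y * y * d - x * x) ≡ (- x) * (- x) - (- y) * (- y) * d
      flip-norm''' = solve-∀

    pr-tri : ∀ x y → PosSurd x y ⊎ ((x ≡ + 0 × y ≡ + 0) ⊎ PosSurd (- x) (- y))
    pr-tri x y with trichotomy x | trichotomy y
    ... | inj₁ p | inj₁ q = inj₁ (inj₁ (pz⇒nn p , pz⇒nn q , λ { (e , _) → pz≢0 p e }))
    ... | inj₁ p | inj₂ (inj₁ q) = inj₁ (inj₁ (pz⇒nn p , (0 , q) , λ { (e , _) → pz≢0 p e }))
    ... | inj₂ (inj₁ p) | inj₁ q = inj₁ (inj₁ ((0 , p) , pz⇒nn q , λ { (_ , e) → pz≢0 q e }))
    ... | inj₂ (inj₁ p) | inj₂ (inj₁ q) = inj₂ (inj₁ (p , q))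
    ... | inj₂ (inj₂ p) | inj₂ (inj₂ q) = inj₂ (inj₂ (inj₁ (pz⇒nn p , pz⇒nn q , λ { (e , _) → pz≢0 p e })))
    ... | inj₂ (inj₂ p) | inj₂ (inj₁ q) = inj₂ (inj₂ (inj₁ (pz⇒nn p , (0 , cong -_ q) , λ { (e , _) → pz≢0 p e })))
    ... | inj₂ (inj₁ p) | inj₂ (inj₂ q) = inj₂ (inj₂ (inj₁ ((0 , cong -_ p) , pz⇒nn q , λ { (_ , e) → pz≢0 q e })))
    ... | inj₁ p | inj₂ (inj₂ q) with trichotomy (x * x - y * y * d)
    ...   | inj₁ r = inj₁ (inj₂ (inj₁ (p , q , r)))
    ...   | inj₂ (inj₁ r) = ⊥-elim (pz≢0 q (cong -_ (irrational x y (from-diff r))))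
    ...   | inj₂ (inj₂ r) = inj₂ (inj₂ (inj₂ (inj₂ (pzS (neg-neg x) p , q , pzS (flip-norm'' x y d) r))))
    pr-tri x y | inj₂ (inj₂ p) | inj₁ q with trichotomy (y * y * d - x * x)
    ...   | inj₁ r = inj₁ (inj₂ (inj₂ (p , q , r)))
    ...   | inj₂ (inj₁ r) = ⊥-elim (pz≢0 q (irrational x y (sym (from-diff r))))
    ...   | inj₂ (inj₂ r) = inj₂ (inj₂ (inj₂ (inj₁ (p , pzS (neg-neg y) q , pzS (flip-norm''' x y d) r))))

-- Irrationality of √d when s² < d < (s+1)² (Fermat descent): from a
-- solution a² = c²d with c > 0 the pair (dc - sa, a - sc) is a solution
-- with 0 < a - sc < c, so only c = 0 can occur.
module Irrationality (d s : ℤ) (ns : NonNeg s)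
    (below : Positive (d - s * s)) (above : Positive ((s + + 1) * (s + + 1) - d)) where

  Solution : ℕ → Set
  Solution n = Σ ℤ λ a → NonNeg a × a * a ≡ + n * + n * d

  private
    gap-below : ∀ a c d s → a * a ≡ c * c * d → a * a - (s * c) * (s * c) ≡ (c * c) * (d - s * s)
    gap-below a c d s e = trans (cong (λ t → t - (s * c) * (s * c)) e) (lem a c d s)
      where lem : ∀ a c d s → c * c * d - (s * c) * (s * c) ≡ (c * c) * (d - s * s)
            lem = solve-∀
    gap-above : ∀ a c d s → a * a ≡ c * c * d →
      ((s + + 1) * c) * ((s + + 1) * c) - a * a ≡ (c * c) * ((s + + 1) * (s + + 1) - d)
    gap-above a c d s e = trans (cong (λ t → ((s + + 1) * c) * ((s + + 1) * c) - t) e) (lem a c d s)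
      where lem : ∀ a c d s → ((s + + 1) * c) * ((s + + 1) * c) - c * c * d
                  ≡ (c * c) * ((s + + 1) * (s + + 1) - d)
            lem = solve-∀
    new-numerator : ∀ a c d s → a * a ≡ c * c * d → (d * c - s * a) * c ≡ a * (a - s * c)
    new-numerator a c d s e = trans (lem1 a c d s) (trans (cong (λ t → t - s * a * c) (sym e)) (lem2 a c s))
      where lem1 : ∀ a c d s → (d * c - s * a) * c ≡ c * c * d - s * a * c
            lem1 = solve-∀
            lem2 : ∀ a c s → a * a - s * a * c ≡ a * (a - s * c)
            lem2 = solve-∀
    new-norm : ∀ a c d s →
      (d * c - s * a) * (d * c - s * a) - (a - s * c) * (a - s * c) * d ≡ (d - s * s) * (c * c * d - a * a)
    new-norm = solve-∀
    split : ∀ a b → a ≡ (a - b) + b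
    split = solve-∀
    complement : ∀ a c s → c - (a - s * c) ≡ (s + + 1) * c - a
    complement = solve-∀

  descend : ∀ m → Solution (suc m) → Σ ℕ λ k → suc k ℕ.< suc m × Solution (suc k)
  descend m (a , na , eq) = k , k<c , A , nA , subst (λ t → A * A ≡ t * t * d) eC eqA
    where
      c = + suc m
      pc : Positive c
      pc = m , refl
      pC : Positive (a - s * c)
      pC = squares-pos na (nn* ns (pz⇒nn pc)) (pzS (sym (gap-below a c d s eq)) (pz* (pz* pc pc) below))
      pC' : Positive ((s + + 1) * c - a)
      pC' = squares-pos (nn* (nn+ ns (1 , refl)) (pz⇒nn pc)) na
              (pzS (sym (gap-above a c d s eq)) (pz* (pz* pc pc) above))
      C = a - s * c
      k = proj₁ pC
      eC : C ≡ + suc k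
      eC = proj₂ pC
      k<c : suc k ℕ.< suc m
      k<c = subst (suc k ℕ.<_) (sym (ZP.+-injective c≡)) (NP.m<n+m (suc k) (ℕ.s≤s ℕ.z≤n))
        where
          j = proj₁ (pzS (sym (complement a c s)) pC')
          c≡ : c ≡ + suc j + + suc k
          c≡ = trans (split c C) (cong₂ _+_ (proj₂ (pzS (sym (complement a c s)) pC')) eC)
      A = d * c - s * a
      nA : NonNeg A
      nA = pzcancel (pzS (sym (new-numerator a c d s eq)) (pz* pa pC)) pc
        where
          pa : Positive a
          pa = pzS (sym (split a (s * c))) (pz+ pC (nn* ns (pz⇒nn pc)))
      eqA : A * A ≡ C * C * d
      eqA = trans (split (A * A) (C * C * d)) (trans (cong (_+ C * C * d) vanish) (ZP.+-identityˡ (C * C * d)))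
        where
          vanish : A * A - C * C * d ≡ + 0
          vanish = trans (new-norm a c d s)
            (trans (cong (λ t → (d - s * s) * (t - a * a)) (sym eq))
              (trans (cong ((d - s * s) *_) (ZP.+-inverseʳ (a * a))) (ZP.*-zeroʳ (d - s * s))))

  only-trivial : ∀ n → Solution n → n ≡ 0
  only-trivial = <-rec (λ n → Solution n → n ≡ 0) step
    where
      step : ∀ n → (∀ {k} → k ℕ.< n → Solution k → k ≡ 0) → Solution n → n ≡ 0
      step zero rec _ = refl
      step (suc m) rec sol =
        ⊥-elim (NP.1+n≢0 (rec (proj₁ (proj₂ (descend m sol))) (proj₂ (proj₂ (descend m sol)))))

  nsqZ : ∀ x y → x * x ≡ y * y * d → y ≡ + 0
  nsqZ x y e = by-signs (nonNeg⊎neg x) (nonNeg⊎neg y)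
    where
      neg-sq : ∀ x → x * x ≡ (- x) * (- x)
      neg-sq = solve-∀
      square-neg : ∀ {n} → - y ≡ + n → y * y * d ≡ + n * + n * d
      square-neg ey = cong (_* d) (trans (neg-sq y) (cong (λ t → t * t) ey))
      trivial : ∀ {a n} → NonNeg a → a * a ≡ + n * + n * d → + n ≡ + 0
      trivial na eq = cong +_ (only-trivial _ (_ , na , eq))
      by-signs : NonNeg x ⊎ Positive (- x) → NonNeg y ⊎ Positive (- y) → y ≡ + 0
      by-signs (inj₁ nx) (inj₁ (n , ey)) = trans ey (trivial nx (trans e (cong (λ t → t * t * d) ey)))
      by-signs (inj₂ px) (inj₁ (n , ey)) =
        trans ey (trivial (pz⇒nn px) (trans (sym (neg-sq x)) (trans e (cong (λ t → t * t * d) ey))))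
      by-signs (inj₁ nx) (inj₂ (n , ey)) =
        trans (sym (ZP.neg-involutive y)) (cong -_ (trans ey (trivial nx (trans e (square-neg ey)))))
      by-signs (inj₂ px) (inj₂ (n , ey)) =
        trans (sym (ZP.neg-involutive y)) (cong -_ (trans ey (trivial (pz⇒nn px) (trans (sym (neg-sq x)) (trans e (square-neg ey))))))

-- Every state (P, Q) is reduced (0 < P ≤ s < P + Q ≤ P + 2s,
-- Q ∣ D - P², s = ⌊√D⌋), which gives the recurrences P' + P = uQ and
-- Q Q' + P'² = D together with u ≥ 1.
module ContinuedFraction (D : ℕ) (D≥2 : 2 ℕ.≤ D) (sf : SquareFree D) where

  isq-le : ∀ n → isqrtGo D n ℕ.* isqrtGo D n ℕ.≤ D
  isq-le zero = ℕ.z≤n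
  isq-le (suc n) with (suc n ℕ.* suc n) ≤ᵇ D in eq
  ... | true = NP.≤ᵇ⇒≤ (suc n ℕ.* suc n) D (subst T (sym eq) tt)
  ... | false = isq-le n

  isq-gt : ∀ n → D ℕ.< suc n ℕ.* suc n → D ℕ.< suc (isqrtGo D n) ℕ.* suc (isqrtGo D n)
  isq-gt zero h = h
  isq-gt (suc n) h with (suc n ℕ.* suc n) ≤ᵇ D in eq
  ... | true = h
  ... | false = isq-gt n (NP.≰⇒> λ le → subst T eq (NP.≤⇒≤ᵇ le))

  s : ℕ
  s = isqrt D

  s-le : s ℕ.* s ℕ.≤ D
  s-le = isq-le D

  s-gt : D ℕ.< suc s ℕ.* suc s
  s-gt = isq-gt D (NP.<-≤-trans (NP.n<1+n D) (NP.m≤m*n (suc D) (suc D)))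

  -- D is squarefree and ≥ 2, hence not a square.
  s≢ : s ℕ.* s ≢ D
  s≢ e = NP.<-irrefl refl (NP.<-≤-trans D≥2 (NP.≤-reflexive (trans (sym e) (cong (λ t → t ℕ.* t) s1))))
    where s1 : s ≡ 1
          s1 = sf s (divides 1 (trans (sym e) (sym (NP.*-identityˡ (s ℕ.* s)))))

  s-lt : s ℕ.* s ℕ.< D
  s-lt = NP.≤∧≢⇒< s-le s≢

  s≥1 : 1 ℕ.≤ s
  s≥1 with s in es
  ... | zero = ⊥-elim (NP.<⇒≱ (subst (λ t → D ℕ.< suc t ℕ.* suc t) es s-gt) (NP.≤-trans (ℕ.s≤s ℕ.z≤n) D≥2))
  ... | suc k = ℕ.s≤s ℕ.z≤n

  d S : ℤ
  d = + D
  S = + s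

  nS : NonNeg S
  nS = nnN s

  pS : Positive S
  pS = from-≥1 s≥1
    where from-≥1 : 1 ℕ.≤ s → Positive S
          from-≥1 le with s
          ... | suc k = k , refl

  hd1 : Positive (d - S * S)
  hd1 = subst (λ t → Positive (d - t)) (pos-* s s) (ltPZ s-lt)

  hd2 : Positive ((S + + 1) * (S + + 1) - d)
  hd2 = subst (λ t → Positive (t - d)) (trans (pos-* (suc s) (suc s)) (cong₂ _*_ (lem s) (lem s))) (ltPZ s-gt)
    where lem : ∀ n → + suc n ≡ + n + + 1
          lem n = cong +_ (NP.+-comm 1 n)

  -- (a + √D)/b is a reduced quadratic irrational with b ∣ D - a².
  record Reduced (a b : ℕ) : Set where
    field
      a-pos : Positive (+ a)
      a≤s : NonNeg (S - + a)
      s<a+b : Positive (+ a + + b - S)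
      b≤a+s : NonNeg (+ a + S - + b)
      cofactor : ℕ
      norm-eq : + b * + cofactor + + a * + a ≡ d
  open Reduced public

  b-pos : ∀ {a b} → Reduced a b → Positive (+ b)
  b-pos {a} {b} iv = pzS (sym (lem (+ a) (+ b) S)) (pz+ (s<a+b iv) (a≤s iv))
    where lem : ∀ a b S → b ≡ (a + b - S) + (S - a)
          lem = solve-∀

  record StepOut (a b : ℕ) : Set where
    field
      so-reduced : Reduced (proj₁ (cfStep D (a , b))) (proj₂ (cfStep D (a , b)))
      so-A : + proj₁ (cfStep D (a , b)) + + a ≡ + ((a ℕ.+ s) div' b) * + b
      so-B : + b * + proj₂ (cfStep D (a , b)) + + proj₁ (cfStep D (a , b)) * + proj₁ (cfStep D (a , b)) ≡ d
      so-u : Positive (+ ((a ℕ.+ s) div' b))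
  open StepOut public

  module Step {a b₀ : ℕ} (iv : Reduced a (suc b₀)) where
    private
      i1 : ∀ U B A S → (U * B + B - A - S) + (S - B) ≡ U * B - A
      i1 = solve-∀
      i2 : ∀ U B A S → (U - + 1) * B + ((B - S) + (S - A)) ≡ U * B - A
      i2 = solve-∀
      i3 : ∀ B c U A → B * (c + + 2 * U * A - U * U * B) + (U * B - A) * (U * B - A) ≡ B * c + A * A
      i3 = solve-∀
      i4 : ∀ d S A' B C → B * C + A' * A' ≡ d → B * C ≡ (d - S * S) + (S - A') * (S + A')
      i4 d S A' B C e = trans (lem d S A' B C) (cong (λ t → t - S * S + (S - A') * (S + A')) e)
        where lem : ∀ d S A' B C → B * C ≡ (B * C + A' * A') - S * S + (S - A') * (S + A')
              lem = solve-∀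
      i5 : ∀ A S U B → S - (U * B - A) ≡ A + S - U * B
      i5 = solve-∀
      i6 : ∀ S A' B B' → S * S - (B * B' + A' * A')
           ≡ (A' + S - B) * B' + (S - A' - B') * ((S - A' - B') + A' + A' + B')
      i6 = solve-∀
      i7 : ∀ U B A S → (U - + 1) * B + (S - A) ≡ (U * B - A) + S - B
      i7 = solve-∀
      i8 : ∀ S A' B B' → B * B' + A' * A' - (S + + 1) * (S + + 1)
           ≡ (S + + 1 - A') * (B' - (A' + S) - + 1) + ((A' + B - S) - + 1) * B'
      i8 = solve-∀
      i9 : ∀ U B A S → U * B + B - A - S ≡ (U * B - A) + B - S
      i9 = solve-∀
      neg-diff : ∀ x y → - (x - y) ≡ y - x
      neg-diff = solve-∀
      flip-diff : ∀ x y → x - y ≡ - (y - x)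
      flip-diff = solve-∀

    b : ℕ
    b = suc b₀
    A B : ℤ
    A = + a
    B = + b

    uu : ℕ
    uu = (a ℕ.+ s) NDM./ b
    U : ℤ
    U = + uu

    floor-le : NonNeg (A + S - U * B)
    floor-le = subst (λ t → NonNeg (A + S - t)) (pos-* uu b) (leNN (NDM.m/n*n≤m (a ℕ.+ s) b))

    floor-gt : Positive (U * B + B - A - S)
    floor-gt = subst (λ x → Positive (x + B - A - S)) (pos-* uu b) (pzS (lem (+ (uu ℕ.* b)) B A S) (ltPZ f2))
      where
        lem : ∀ x B A S → x + B - (A + S) ≡ x + B - A - S
        lem = solve-∀
        f2 : a ℕ.+ s ℕ.< uu ℕ.* b ℕ.+ b
        f2 = subst (λ t → t ℕ.< uu ℕ.* b ℕ.+ b) (sym (NDM.m≡m%n+[m/n]*n (a ℕ.+ s) b))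
               (subst (λ t → (a ℕ.+ s) NDM.% b ℕ.+ uu ℕ.* b ℕ.< t) (NP.+-comm b (uu ℕ.* b))
                 (NP.+-monoˡ-< (uu ℕ.* b) (NDM.m%n<n (a ℕ.+ s) b)))

    -- u ≥ 1 because b ≤ a + s.
    pU : Positive U
    pU with uu in eu
    ... | suc k = k , refl
    ... | zero = ⊥-elim (nn-negpz (b≤a+s iv) (pzS (lem A B S) (subst (λ t → Positive (+ t * B + B - A - S)) eu floor-gt)))
      where lem : ∀ A B S → + 0 * B + B - A - S ≡ - (A + S - B)
            lem = solve-∀

    pUBA : Positive (U * B - A)
    pUBA with nonNeg⊎neg (S - B)
    ... | inj₁ n = pzS (i1 U B A S) (pz+ floor-gt n)
    ... | inj₂ p = pzS (i2 U B A S) (pz+' (nn* (pz-1 pU) (pz⇒nn (b-pos iv))) (pz+ (pzS (neg-diff S B) p) (a≤s iv)))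

    a' : ℕ
    a' = uu ℕ.* b ℕ.∸ a
    A' : ℤ
    A' = + a'

    eA : A' ≡ U * B - A
    eA = trans (∸-pos a≤ub) (cong (_- A) (pos-* uu b))
      where a≤ub : a ℕ.≤ uu ℕ.* b
            a≤ub = NP.<⇒≤ (pzLt (subst (λ t → Positive (t - A)) (sym (pos-* uu b)) pUBA))

    eA' : A' + A ≡ U * B
    eA' = trans (cong (_+ A) eA) (lem (U * B) A)
      where lem : ∀ x y → x - y + y ≡ x
            lem = solve-∀

    a'≤s : NonNeg (S - A')
    a'≤s = nnS (trans (sym (i5 A S U B)) (cong (λ t → S - t) (sym eA))) floor-le

    C' : ℤ
    C' = + cofactor iv + + 2 * U * A - U * U * B

    eBC : B * C' + A' * A' ≡ d
    eBC = trans (cong (λ t → B * C' + t * t) eA) (trans (i3 B (+ cofactor iv) U A) (norm-eq iv))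

    nC' : NonNeg C'
    nC' = pzcancel (pzS (ZP.*-comm B C') pBC) (b-pos iv)
      where pBC : Positive (B * C')
            pBC = pzS (sym (i4 d S A' B C' eBC)) (pz+ hd1 (nn* a'≤s (nn+ nS (nnN a'))))

    B' : ℤ
    B' = + ((D ℕ.∸ a' ℕ.* a') NDM./ b)

    eB' : B' ≡ C'
    eB' = trans (cong +_ quotient) (sym (proj₂ nC'))
      where
        c' = proj₁ nC'
        eN : b ℕ.* c' ℕ.+ a' ℕ.* a' ≡ D
        eN = ZP.+-injective (trans (pos-+ (b ℕ.* c') (a' ℕ.* a'))
               (trans (cong₂ _+_ (pos-* b c') (pos-* a' a')) (trans (cong (λ t → B * t + A' * A') (sym (proj₂ nC'))) eBC)))
        quotient : (D ℕ.∸ a' ℕ.* a') NDM./ b ≡ c'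
        quotient = trans (cong (NDM._/ b) (trans (cong (ℕ._∸ a' ℕ.* a') (sym eN))
                     (trans (NP.m+n∸n≡m (b ℕ.* c') (a' ℕ.* a')) (NP.*-comm b c')))) (NDM.m*n/n≡m c' b)

    eB : B * B' + A' * A' ≡ d
    eB = trans (cong (λ t → B * t + A' * A') eB') eBC

    private
      square-too-big : NonNeg (S - A' - B') → ⊥
      square-too-big h = nn-negpz (nnS (cong (λ t → S * S - t) eB)
          (nnS (sym (i6 S A' B B')) (nn+ (nn* a'+s≥b (nnN _)) (nn* h (nnS (sym (lem S A' B')) (nn+ nS (nnN a')))))))
          (pzS (flip-diff d (S * S)) hd1)
        where
          lem : ∀ S A' B' → (S - A' - B') + A' + A' + B' ≡ S + A'
          lem = solve-∀
          a'+s≥b : NonNeg (A' + S - B)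
          a'+s≥b = nnS (trans (i7 U B A S) (cong (λ t → t + S - B) (sym eA))) (nn+ (nn* (pz-1 pU) (pz⇒nn (b-pos iv))) (a≤s iv))

    -- s < a' + b': otherwise s² ≥ b b' + a'² = D
    s<a'+b' : Positive (A' + B' - S)
    s<a'+b' with nonNeg⊎neg (A' + B' - S)
    ... | inj₁ (suc k , e) = k , e
    ... | inj₁ (zero , e) = ⊥-elim (square-too-big (0 , trans (lem S A' B') (cong -_ e)))
      where lem : ∀ S A' B' → S - A' - B' ≡ - (A' + B' - S)
            lem = solve-∀
    ... | inj₂ p = ⊥-elim (square-too-big (pz⇒nn (pzS (lem S A' B') p)))
      where lem : ∀ S A' B' → - (A' + B' - S) ≡ S - A' - B'
            lem = solve-∀
    -- b' ≤ a' + s: otherwise (s + 1)² ≤ b b' + a'² = D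
    b'≤a'+s : NonNeg (A' + S - B')
    b'≤a'+s with nonNeg⊎neg (A' + S - B')
    ... | inj₁ n = n
    ... | inj₂ p = ⊥-elim (nn-negpz (nnS (cong (λ t → t - (S + + 1) * (S + + 1)) eB)
          (nnS (sym (i8 S A' B B')) (nn+ (nn* (pz⇒nn (pzS (lem S A') (pz+' a'≤s (0 , refl)))) (pz-1 (pzS (neg-diff (A' + S) B') p)))
            (nn* (pz-1 a'+b>s) (nnN _)))))
          (pzS (flip-diff ((S + + 1) * (S + + 1)) d) hd2))
      where
        lem : ∀ S A' → S - A' + + 1 ≡ S + + 1 - A'
        lem = solve-∀
        a'+b>s : Positive (A' + B - S)
        a'+b>s = pzS (trans (i9 U B A S) (cong (λ t → t + B - S) (sym eA))) floor-gt

    reduced' : Reduced a' ((D ℕ.∸ a' ℕ.* a') NDM./ b)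
    reduced' = record
      { a-pos = pzS (sym eA) pUBA ; a≤s = a'≤s ; s<a+b = s<a'+b' ; b≤a+s = b'≤a'+s
      ; cofactor = b ; norm-eq = trans (cong (_+ A' * A') (ZP.*-comm B' B)) eB }

  step : ∀ {a b} → Reduced a b → StepOut a b
  step {a} {zero} iv = ⊥-elim (pz≢0 (b-pos iv) refl)
  step {a} {suc b₀} iv = record { so-reduced = reduced' ; so-A = eA' ; so-B = eB ; so-u = pU }
    where open Step iv

  -- Starting values.  For D ≡ 1 (mod 4) the first complete quotient is
  -- (2t + 1 + √D)/2 with s = 2t + 1 + r, r < 2; otherwise it is (s + √D)/1.
  divU : ∀ r q → r ℕ.< 2 → (r ℕ.+ q ℕ.* 2) NDM./ 2 ≡ q
  divU r q lt = trans (NDM.+-distrib-/-∣ʳ r (divides q refl)) (cong₂ ℕ._+_ (NDM.m<n⇒m/n≡0 lt) (NDM.m*n/n≡m q 2))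

  t r : ℕ
  t = (s ℕ.∸ 1) NDM./ 2
  r = (s ℕ.∸ 1) NDM.% 2
  r<2 : r ℕ.< 2
  r<2 = NDM.m%n<n (s ℕ.∸ 1) 2
  s-dec : s ≡ suc (r ℕ.+ t ℕ.* 2)
  s-dec = trans (sym (NP.m+[n∸m]≡n s≥1)) (cong suc (NDM.m≡m%n+[m/n]*n (s ℕ.∸ 1) 2))

  start-T : oneMod4 D ≡ true → cfStart D ≡ (suc (2 ℕ.* t) , 2)
  start-T eq = cong (λ b → if b then (suc (2 ℕ.* ((isqrt D ℕ.∸ 1) div' 2)) , 2) else (isqrt D , 1)) eq
  start-F : oneMod4 D ≡ false → cfStart D ≡ (s , 1)
  start-F eq = cong (λ b → if b then (suc (2 ℕ.* ((isqrt D ℕ.∸ 1) div' 2)) , 2) else (isqrt D , 1)) eq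

  u0-T : oneMod4 D ≡ true → u D 0 ≡ suc (2 ℕ.* t)
  u0-T eq = trans (cong (λ p → (proj₁ p ℕ.+ isqrt D) div' proj₂ p) (start-T eq))
     (trans (cong (NDM._/ 2) e) (divU r (suc (2 ℕ.* t)) r<2))
    where e : suc (2 ℕ.* t) ℕ.+ s ≡ r ℕ.+ suc (2 ℕ.* t) ℕ.* 2
          e = trans (cong (suc (2 ℕ.* t) ℕ.+_) s-dec) (lem r t)
            where lem : ∀ r t → suc (2 ℕ.* t) ℕ.+ suc (r ℕ.+ t ℕ.* 2) ≡ r ℕ.+ suc (2 ℕ.* t) ℕ.* 2
                  lem = ℕSolver.solve-∀
  u0-F : oneMod4 D ≡ false → u D 0 ≡ s ℕ.+ s
  u0-F eq = trans (cong (λ p → (proj₁ p ℕ.+ isqrt D) div' proj₂ p) (start-F eq)) (NDM.n/1≡n (s ℕ.+ s))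

  p0-T : oneMod4 D ≡ true → proj₁ (pq D 1) ≡ suc t
  p0-T eq = trans (cong (λ v → suc v div' 2) (u0-T eq)) (trans (cong (NDM._/ 2) (lem t)) (divU 0 (suc t) (ℕ.s≤s ℕ.z≤n)))
    where lem : ∀ t → suc (suc (2 ℕ.* t)) ≡ 0 ℕ.+ suc t ℕ.* 2
          lem = ℕSolver.solve-∀
  p0-F : oneMod4 D ≡ false → proj₁ (pq D 1) ≡ s
  p0-F eq = trans (cong (λ v → suc v div' 2) (u0-F eq)) (trans (cong (NDM._/ 2) (lem s)) (divU 1 s (ℕ.s≤s (ℕ.s≤s ℕ.z≤n))))
    where lem : ∀ s → suc (s ℕ.+ s) ≡ 1 ℕ.+ s ℕ.* 2
          lem = ℕSolver.solve-∀

  private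
    eS : S ≡ + 1 + (+ r + + t * + 2)
    eS = trans (cong +_ s-dec) (cong (λ z → + 1 + (+ r + z)) (pos-* t 2))
    eA0 : + suc (2 ℕ.* t) ≡ + 1 + + 2 * + t
    eA0 = cong (λ z → + 1 + z) (pos-* 2 t)
    D%4 : oneMod4 D ≡ true → D NDM.% 4 ≡ 1
    D%4 eq = NP.≡ᵇ⇒≡ (D NDM.% 4) 1 (subst T (sym eq) tt)
    eD : oneMod4 D ≡ true → d ≡ + 1 + + (D NDM./ 4) * + 4
    eD eq = trans (cong +_ (trans (NDM.m≡m%n+[m/n]*n D 4) (cong (ℕ._+ (D NDM./ 4) ℕ.* 4) (D%4 eq)))) (cong (λ z → + 1 + z) (pos-* (D NDM./ 4) 4))

  -- the starting state is reduced; for D = 4M + 1 the cofactor is 2(M - t² - t)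
  reduced-start-1mod4 : oneMod4 D ≡ true → Reduced (suc (2 ℕ.* t)) 2
  reduced-start-1mod4 eq = record { a-pos = (2 ℕ.* t , refl) ; a≤s = a≤s₀ ; s<a+b = s<a+b₀ ; b≤a+s = b≤a+s₀ ; cofactor = proj₁ cofactor₀ ; norm-eq = norm-eq₀ }
    where
      A0 = + suc (2 ℕ.* t)
      R = + r
      T' = + t
      M = + (D NDM./ 4)
      a≤s₀ : NonNeg (S - A0)
      a≤s₀ = nnS (sym (trans (cong₂ _-_ eS eA0) (lem R T'))) (nnN r)
        where lem : ∀ R T' → (+ 1 + (R + T' * + 2)) - (+ 1 + + 2 * T') ≡ R
              lem = solve-∀
      s<a+b₀ : Positive (A0 + + 2 - S)
      s<a+b₀ = pzS (sym (trans (cong₂ (λ x y → x + + 2 - y) eA0 eS) (lem R T'))) (ltPZ r<2)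
        where lem : ∀ R T' → (+ 1 + + 2 * T') + + 2 - (+ 1 + (R + T' * + 2)) ≡ + 2 - R
              lem = solve-∀
      b≤a+s₀ : NonNeg (A0 + S - + 2)
      b≤a+s₀ = nnS (sym (trans (cong₂ (λ x y → x + y - + 2) eA0 eS) (lem R T'))) (nn+ (nnN r) (nn* (nnN t) (nnN 4)))
        where lem : ∀ R T' → (+ 1 + + 2 * T') + (+ 1 + (R + T' * + 2)) - + 2 ≡ R + T' * + 4
              lem = solve-∀
      a²<D : Positive (d - A0 * A0)
      a²<D = pzS (sym (lem d S A0)) (pz+ hd1 (nn* a≤s₀ (nn+ nS (nnN _))))
        where lem : ∀ d S A0 → d - A0 * A0 ≡ (d - S * S) + (S - A0) * (S + A0)
              lem = solve-∀
      quarter-gap : Positive ((M - T' * T' - T') * + 4)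
      quarter-gap = pzS (trans (cong₂ (λ x y → x - y * y) (eD eq) eA0) (lem M T')) a²<D
        where lem : ∀ M T' → (+ 1 + M * + 4) - (+ 1 + + 2 * T') * (+ 1 + + 2 * T') ≡ (M - T' * T' - T') * + 4
              lem = solve-∀
      cofactor₀ : NonNeg (+ 2 * (M - T' * T' - T'))
      cofactor₀ = nn* (nnN 2) (pzcancel quarter-gap (3 , refl))
      norm-eq₀ : + 2 * + proj₁ cofactor₀ + A0 * A0 ≡ d
      norm-eq₀ = trans (cong (λ z → + 2 * z + A0 * A0) (sym (proj₂ cofactor₀))) (trans (cong (λ z → + 2 * (+ 2 * (M - T' * T' - T')) + z * z) eA0) (trans (lem M T') (sym (eD eq))))
        where lem : ∀ M T' → + 2 * (+ 2 * (M - T' * T' - T')) + (+ 1 + + 2 * T') * (+ 1 + + 2 * T') ≡ + 1 + M * + 4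
              lem = solve-∀

  reduced-start-other : Reduced s 1
  reduced-start-other = record { a-pos = pS ; a≤s = (0 , ZP.+-inverseʳ S) ; s<a+b = (0 , lem S) ; b≤a+s = nnS (lem2 S) (nn+ (pz-1 pS) nS) ; cofactor = proj₁ D-s² ; norm-eq = norm-eq₀ }
    where
      lem : ∀ S → S + + 1 - S ≡ + 1
      lem = solve-∀
      lem2 : ∀ S → (S - + 1) + S ≡ S + S - + 1
      lem2 = solve-∀
      D-s² : NonNeg (d - S * S)
      D-s² = pz⇒nn hd1
      norm-eq₀ : + 1 * + proj₁ D-s² + S * S ≡ d
      norm-eq₀ = trans (cong (λ z → + 1 * z + S * S) (sym (proj₂ D-s²))) (lem3 d (S * S))
        where lem3 : ∀ d x → + 1 * (d - x) + x ≡ d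
              lem3 = solve-∀

  reduced-start : Reduced (proj₁ (cfStart D)) (proj₂ (cfStart D))
  reduced-start = by-residue (oneMod4 D) refl
    where
      by-residue : ∀ b → oneMod4 D ≡ b → Reduced (proj₁ (cfStart D)) (proj₂ (cfStart D))
      by-residue true eq = subst (λ p → Reduced (proj₁ p) (proj₂ p)) (sym (start-T eq)) (reduced-start-1mod4 eq)
      by-residue false eq = subst (λ p → Reduced (proj₁ p) (proj₂ p)) (sym (start-F eq)) reduced-start-other

  reducedAll : ∀ n → Reduced (proj₁ (cfState D n)) (proj₂ (cfState D n))
  reducedAll zero = reduced-start
  reducedAll (suc n) = so-reduced (step (reducedAll n))

  An Bn Un : ℕ → ℤ
  An n = + proj₁ (cfState D n)
  Bn n = + proj₂ (cfState D n)
  Un n = + u D n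

  stepA : ∀ n → An (suc n) + An n ≡ Un n * Bn n
  stepA n = so-A (step (reducedAll n))
  stepB : ∀ n → Bn n * Bn (suc n) + An (suc n) * An (suc n) ≡ d
  stepB n = so-B (step (reducedAll n))
  uPos : ∀ n → Positive (Un n)
  uPos n = so-u (step (reducedAll n))
  Apos : ∀ n → Positive (An n)
  Apos n = a-pos (reducedAll n)
  Bpos : ∀ n → Positive (Bn n)
  Bpos n = b-pos (reducedAll n)

cong₃ : ∀ {A B C E : Set} (f : A → B → C → E) {a a' b b' c c'} →
        a ≡ a' → b ≡ b' → c ≡ c' → f a b c ≡ f a' b' c'
cong₃ f refl refl refl = refl

cong₄ : ∀ {A B C E F : Set} (f : A → B → C → E → F) {a a' b b' c c' e e'} →
        a ≡ a' → b ≡ b' → c ≡ c' → e ≡ e' → f a b c e ≡ f a' b' c' e'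
cong₄ f refl refl refl refl = refl

-- With T₀ = Q_0 ∈ {1, 2}, the element α_{n-1} equals
-- (X_n + q_{n-1}√D)/T₀ where X_n = T₀p_{n-1} - (T₀ - 1)q_{n-1}; the
-- identities below express X_n and the norm of α_{n-1} through P_n, Q_n.
module Convergents (D : ℕ) (D≥2 : 2 ℕ.≤ D) (sf : SquareFree D) where
  open ContinuedFraction D D≥2 sf public

  Pn Qn : ℕ → ℤ
  Pn n = + proj₁ (pq D n)
  Qn n = + proj₂ (pq D n)

  recP : ∀ n → Pn (suc (suc n)) ≡ Un (suc n) * Pn (suc n) + Pn n
  recP n = cong (λ z → z + Pn n) (pos-* (u D (suc n)) (proj₁ (pq D (suc n))))

  recQ : ∀ n → Qn (suc (suc n)) ≡ Un (suc n) * Qn (suc n) + Qn n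
  recQ n = cong (λ z → z + Qn n) (pos-* (u D (suc n)) (proj₂ (pq D (suc n))))

  T₀ : ℤ
  T₀ = Bn 0

  X : ℕ → ℤ
  X n = T₀ * Pn n - (T₀ - + 1) * Qn n

  recX : ∀ n → X (suc (suc n)) ≡ Un (suc n) * X (suc n) + X n
  recX n = trans (cong₂ (λ p q → T₀ * p - (T₀ - + 1) * q) (recP n) (recQ n))
                 (lem T₀ (Un (suc n)) (Pn (suc n)) (Pn n) (Qn (suc n)) (Qn n))
    where lem : ∀ T U p1 p0 q1 q0 → T * (U * p1 + p0) - (T - + 1) * (U * q1 + q0)
                ≡ U * (T * p1 - (T - + 1) * q1) + (T * p0 - (T - + 1) * q0)
          lem = solve-∀

  alt : ℕ → ℤ
  alt zero = + 1
  alt (suc m) = - alt m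

  X₀≡ : X 0 ≡ Bn 0
  X₀≡ = lem T₀
    where lem : ∀ T → T * + 1 - (T - + 1) * + 0 ≡ T
          lem = solve-∀

  X₁≡ : X 1 ≡ Un 0 * Bn 0 - An 0
  X₁≡ = by-residue (oneMod4 D) refl
    where
      by-residue : ∀ b → oneMod4 D ≡ b → X 1 ≡ Un 0 * Bn 0 - An 0
      by-residue true eq = trans (cong₂ (λ T p → T * p - (T - + 1) * + 1) eB (cong +_ (p0-T eq)))
          (trans (trans (lem (+ t)) (sym (lem2 (+ t)))) (cong₃ (λ U B A → U * B - A) (sym eU) (sym eB) (sym eA)))
        where
          eB : Bn 0 ≡ + 2
          eB = cong (λ p → + proj₂ p) (start-T eq)
          eU : Un 0 ≡ + 1 + + 2 * + t
          eU = trans (cong +_ (u0-T eq)) (cong (λ z → + 1 + z) (pos-* 2 t))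
          eA : An 0 ≡ + 1 + + 2 * + t
          eA = trans (cong (λ p → + proj₁ p) (start-T eq)) (cong (λ z → + 1 + z) (pos-* 2 t))
          lem : ∀ t → + 2 * (+ 1 + t) - (+ 2 - + 1) * + 1 ≡ + 1 + + 2 * t
          lem = solve-∀
          lem2 : ∀ t → (+ 1 + + 2 * t) * + 2 - (+ 1 + + 2 * t) ≡ + 1 + + 2 * t
          lem2 = solve-∀
      by-residue false eq = trans (cong₂ (λ T p → T * p - (T - + 1) * + 1) eB (cong +_ (p0-F eq)))
          (trans (lem S) (cong₃ (λ U B A → U * B - A) (cong +_ (sym (u0-F eq))) (sym eB) (sym eA)))
        where
          eB : Bn 0 ≡ + 1
          eB = cong (λ p → + proj₂ p) (start-F eq)
          eA : An 0 ≡ S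
          eA = cong (λ p → + proj₁ p) (start-F eq)
          lem : ∀ S → + 1 * S - (+ 1 - + 1) * + 1 ≡ (S + S) * + 1 - S
          lem = solve-∀

  record ConvergentIdentities (m : ℕ) : Set where
    field
      rational-part : X (suc m) ≡ An (suc m) * Qn (suc m) + Bn (suc m) * Qn m
      surd-part : An (suc m) * X (suc m) + Bn (suc m) * X m ≡ d * Qn (suc m)
      determinant : Pn m * Qn (suc m) - Qn m * Pn (suc m) ≡ alt m
  open ConvergentIdentities public

  private
    to-zero : ∀ {a b} → a ≡ b → a - b ≡ + 0
    to-zero {a} {b} e = trans (cong (_- b) e) (ZP.+-inverseʳ b)
    from-zero : ∀ {a b} → a - b ≡ + 0 → a ≡ b
    from-zero {a} {b} e = trans (lem a b) (trans (cong (_+ b) e) (ZP.+-identityˡ b))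
      where lem : ∀ a b → a ≡ (a - b) + b
            lem = solve-∀
    cancel-pos : ∀ {b x} → Positive b → b * x ≡ + 0 → x ≡ + 0
    cancel-pos {b} {x} pb e with trichotomy x
    ... | inj₁ p = ⊥-elim (pz≢0 (pz* pb p) e)
    ... | inj₂ (inj₁ z) = z
    ... | inj₂ (inj₂ p) = ⊥-elim (pz≢0 (pzS (lem b x) (pz* pb p)) (cong -_ e))
      where lem : ∀ b x → b * (- x) ≡ - (b * x)
            lem = solve-∀

  identities-base : ConvergentIdentities 0
  identities-base = record
    { rational-part = x₁
    ; surd-part = trans (cong₂ (λ x y → An 1 * x + Bn 1 * y) x₁ X₀≡) (lem2 (An 1) (Bn 0) (Bn 1) d (stepB 0))
    ; determinant = refl }
    where
      lem1 : ∀ a1 a0 ub → a1 + a0 ≡ ub → ub - a0 ≡ a1 * + 1 + (Bn 1) * + 0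
      lem1 a1 a0 ub e = trans (cong (_- a0) (sym e)) (lem a1 a0 (Bn 1))
        where lem : ∀ a1 a0 b → a1 + a0 - a0 ≡ a1 * + 1 + b * + 0
              lem = solve-∀
      x₁ = trans X₁≡ (lem1 (An 1) (An 0) (Un 0 * Bn 0) (stepA 0))
      lem2 : ∀ a1 b0 b1 d → b0 * b1 + a1 * a1 ≡ d → a1 * (a1 * + 1 + b1 * + 0) + b1 * b0 ≡ d * + 1
      lem2 a1 b0 b1 d e = trans (lem a1 b0 b1) (trans e (sym (ZP.*-identityʳ d)))
        where lem : ∀ a1 b0 b1 → a1 * (a1 * + 1 + b1 * + 0) + b1 * b0 ≡ b0 * b1 + a1 * a1
              lem = solve-∀

  -- Induction step.  The first two identities for m + 1 follow after
  -- multiplying by Q_{m+1} > 0 from those for m and the two recurrences.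
  private
    c1 : ∀ a b a2 b2 U X1 X0 q1 q0 d →
      b * (U * X1 + X0 - (a2 * (U * q1 + q0) + b2 * q1))
      ≡ (a2 * q1 - X1) * (a2 + a - U * b) + (a * X1 + b * X0 - d * q1)
        + a2 * (X1 - (a * q1 + b * q0)) - q1 * (b * b2 + a2 * a2 - d)
    c1 = solve-∀
    c2 : ∀ a b a2 b2 U X1 X0 q1 q0 d →
      b * (a2 * (U * X1 + X0) + b2 * X1 - d * (U * q1 + q0))
      ≡ (d * q1 - a2 * X1) * (a2 + a - U * b) + a2 * (a * X1 + b * X0 - d * q1)
        + X1 * (b * b2 + a2 * a2 - d) + d * (X1 - (a * q1 + b * q0))
    c2 = solve-∀
    k1 : ∀ x y z → x * + 0 + + 0 + y * + 0 - z * + 0 ≡ + 0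
    k1 = solve-∀
    k2 : ∀ x y z w → x * + 0 + y * + 0 + z * + 0 + w * + 0 ≡ + 0
    k2 = solve-∀
    c3 : ∀ p1 p0 q1 q0 U → p1 * (U * q1 + q0) - q1 * (U * p1 + p0) ≡ - (p0 * q1 - q0 * p1)
    c3 = solve-∀

  identities-step : ∀ m → ConvergentIdentities m → ConvergentIdentities (suc m)
  identities-step m jm = record { rational-part = nj1 ; surd-part = nj2 ; determinant = nj3 }
    where
      a = An (suc m)
      b = Bn (suc m)
      a2 = An (suc (suc m))
      b2 = Bn (suc (suc m))
      U = Un (suc m)
      X1 = X (suc m)
      X0 = X m
      q1 = Qn (suc m)
      q0 = Qn m
      HA = to-zero (stepA (suc m))
      HB = to-zero (stepB (suc m))
      H3 = to-zero (rational-part jm)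
      H4 = to-zero (surd-part jm)
      nj1 : X (suc (suc m)) ≡ a2 * Qn (suc (suc m)) + b2 * q1
      nj1 = trans (recX m) (trans (from-zero (cancel-pos (Bpos (suc m))
              (trans (c1 a b a2 b2 U X1 X0 q1 q0 d)
                (trans (cong₄ (λ w x y z → (a2 * q1 - X1) * w + x + a2 * y - q1 * z) HA H4 H3 HB)
                  (k1 (a2 * q1 - X1) a2 q1)))))
              (cong (λ z → a2 * z + b2 * q1) (sym (recQ m))))
      nj2 : a2 * X (suc (suc m)) + b2 * X1 ≡ d * Qn (suc (suc m))
      nj2 = trans (cong (λ z → a2 * z + b2 * X1) (recX m)) (trans (from-zero (cancel-pos (Bpos (suc m))
              (trans (c2 a b a2 b2 U X1 X0 q1 q0 d)
                (trans (cong₄ (λ w x y z → (d * q1 - a2 * X1) * w + a2 * x + X1 * y + d * z) HA H4 HB H3)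
                  (k2 (d * q1 - a2 * X1) a2 X1 d)))))
              (cong (d *_) (sym (recQ m))))
      nj3 : Pn (suc m) * Qn (suc (suc m)) - Qn (suc m) * Pn (suc (suc m)) ≡ alt (suc m)
      nj3 = trans (cong₂ (λ q p → Pn (suc m) * q - Qn (suc m) * p) (recQ m) (recP m))
              (trans (c3 (Pn (suc m)) (Pn m) q1 q0 U) (cong -_ (determinant jm)))

  identities : ∀ m → ConvergentIdentities m
  identities zero = identities-base
  identities (suc m) = identities-step m (identities m)

-- Signs of α_{n-1} and its conjugate: α_{n-1} > 0 always, while the norm
-- X_n² - q_{n-1}²D = -(-1)^{n-1} T₀ Q_n makes α_{n-1}' positive for odd
-- n - 1 = 2k - 1 and negative for even n - 1 = 2k.
module ConvergentSigns (D : ℕ) (D≥2 : 2 ℕ.≤ D) (sf : SquareFree D) where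
  open Convergents D D≥2 sf public
  open SurdSign d (nnN D) public
  open Irrationality d S nS hd1 hd2 public using (nsqZ)
  open Trichotomy nsqZ public

  private
    norm-expansion : ∀ T P1 P0 q1 q0 a b d g →
      (T * P1 - (T - + 1) * q1) * (T * P1 - (T - + 1) * q1) - q1 * q1 * d + T * b * g
      ≡ (T * P1 - (T - + 1) * q1) * ((T * P1 - (T - + 1) * q1) - (a * q1 + b * q0))
        + q1 * (a * (T * P1 - (T - + 1) * q1) + b * (T * P0 - (T - + 1) * q0) - d * q1)
        - b * T * ((P0 * q1 - q0 * P1) - g)
    norm-expansion = solve-∀
    to-zero : ∀ {a b} → a ≡ b → a - b ≡ + 0
    to-zero {a} {b} e = trans (cong (_- b) e) (ZP.+-inverseʳ b)
    vanish : ∀ x y z → x * + 0 + y * + 0 - z * + 0 ≡ + 0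
    vanish = solve-∀
    move : ∀ x y → x + y ≡ + 0 → x ≡ - y
    move x y e = trans (lem x y) (trans (cong (_- y) e) (ZP.+-identityˡ (- y)))
      where lem : ∀ x y → x ≡ (x + y) - y
            lem = solve-∀

  -- norm of α_m, scaled by T₀²
  norm : ∀ m → X (suc m) * X (suc m) - Qn (suc m) * Qn (suc m) * d ≡ - (T₀ * Bn (suc m) * alt m)
  norm m = move _ _
    (trans (norm-expansion T₀ (Pn (suc m)) (Pn m) (Qn (suc m)) (Qn m) (An (suc m)) (Bn (suc m)) d (alt m))
      (trans (cong₃ (λ x y z → X (suc m) * x + Qn (suc m) * y - Bn (suc m) * T₀ * z)
                    (to-zero (rational-part (identities m))) (to-zero (surd-part (identities m)))
                    (to-zero (determinant (identities m))))
        (vanish (X (suc m)) (Qn (suc m)) (Bn (suc m) * T₀))))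

  double-suc : ∀ k → 2 ℕ.* suc k ≡ suc (suc (2 ℕ.* k))
  double-suc k = NP.*-suc 2 k

  alt-even : ∀ k → alt (2 ℕ.* k) ≡ + 1
  alt-even zero = refl
  alt-even (suc k) = trans (cong alt (double-suc k)) (trans (ZP.neg-involutive (alt (2 ℕ.* k))) (alt-even k))

  q-pos : ∀ m → Positive (Qn (suc m)) × NonNeg (Qn m)
  q-pos zero = (0 , refl) , (0 , refl)
  q-pos (suc m) = pzS (sym (recQ m)) (pz+ (pz* (uPos (suc m)) (proj₁ (q-pos m))) (proj₂ (q-pos m))) ,
                  pz⇒nn (proj₁ (q-pos m))

  x-pos : ∀ n → Positive (X n)
  x-pos zero = pzS (sym X₀≡) (Bpos 0)
  x-pos (suc m) = pzS (sym (rational-part (identities m)))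
    (pz+ (pz* (Apos (suc m)) (proj₁ (q-pos m))) (nn* (pz⇒nn (Bpos (suc m))) (proj₂ (q-pos m))))

  T₀B-pos : ∀ m → Positive (T₀ * Bn (suc m))
  T₀B-pos m = pz* (Bpos 0) (Bpos (suc m))

  private
    neg-neg : ∀ x → - (- x) ≡ x
    neg-neg = ZP.neg-involutive
    neg-sq : ∀ q d → (- q) * (- q) * d ≡ q * q * d
    neg-sq = solve-∀
    neg-minus-one : ∀ t → - (t * (- + 1)) ≡ t
    neg-minus-one = solve-∀
    flip-norm : ∀ q d x t → x * x - q * q * d ≡ - (t * + 1) → q * q * d - (- x) * (- x) ≡ t
    flip-norm q d x t e = trans (lem q d x) (trans (cong -_ e) (lem2 t))
      where lem : ∀ q d x → q * q * d - (- x) * (- x) ≡ - (x * x - q * q * d)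
            lem = solve-∀
            lem2 : ∀ t → - (- (t * + 1)) ≡ t
            lem2 = solve-∀

  α-pos : ∀ n → PosSurd (X n) (Qn n)
  α-pos zero = inj₁ (pz⇒nn (x-pos 0) , (0 , refl) , λ { (e , _) → pz≢0 (x-pos 0) e })
  α-pos (suc m) = inj₁ (pz⇒nn (x-pos (suc m)) , pz⇒nn (proj₁ (q-pos m)) , λ { (e , _) → pz≢0 (x-pos (suc m)) e })

  conj-α-even-pos : ∀ k → PosSurd (X (2 ℕ.* k)) (- Qn (2 ℕ.* k))
  conj-α-even-pos zero = inj₁ (pz⇒nn (x-pos 0) , (0 , refl) , λ { (e , _) → pz≢0 (x-pos 0) e })
  conj-α-even-pos (suc k) = subst (λ n → PosSurd (X n) (- Qn n)) (sym (double-suc k)) dominant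
    where
      m = suc (2 ℕ.* k)
      norm-pos : Positive (X (suc m) * X (suc m) - (- Qn (suc m)) * (- Qn (suc m)) * d)
      norm-pos = pzS (trans (sym (neg-minus-one (T₀ * Bn (suc m))))
          (trans (cong (λ z → - (T₀ * Bn (suc m) * z)) (sym (cong -_ (alt-even k))))
            (trans (sym (norm m)) (cong (λ z → X (suc m) * X (suc m) - z) (sym (neg-sq (Qn (suc m)) d))))))
          (T₀B-pos m)
      dominant : PosSurd (X (suc m)) (- Qn (suc m))
      dominant = inj₂ (inj₁ (x-pos (suc m) , pzS (sym (neg-neg _)) (proj₁ (q-pos m)) , norm-pos))

  conj-α-odd-neg : ∀ k → PosSurd (- X (suc (2 ℕ.* k))) (Qn (suc (2 ℕ.* k)))
  conj-α-odd-neg k = inj₂ (inj₂ (pzS (sym (neg-neg _)) (x-pos (suc m)) , proj₁ (q-pos m) ,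
      pzS (sym (flip-norm (Qn (suc m)) d (X (suc m)) (T₀ * Bn (suc m))
            (trans (norm m) (cong (λ z → - (T₀ * Bn (suc m) * z)) (alt-even k))))) (T₀B-pos m)))
    where m = 2 ℕ.* k

module IntegerOrder where
  private
    ab : ∀ a b → b ≡ a + (b - a)
    ab = solve-∀
    ng : ∀ a b → - (b - a) ≡ a - b
    ng = solve-∀

  pzLtZ : ∀ {a b} → Positive (b - a) → a ℤ.< b
  pzLtZ {a} {b} (n , e) = subst₂ ℤ._<_ (ZP.+-identityʳ a) (sym (trans (ab a b) (cong (λ t → a + t) e))) (ZP.+-monoʳ-< a (ℤ.+<+ (ℕ.s≤s ℕ.z≤n)))

  ltd : ∀ {a b} → a ℤ.< b → Positive (b - a)
  ltd {a} {b} lt with trichotomy (b - a)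
  ... | inj₁ p = p
  ... | inj₂ (inj₁ z) = ⊥-elim (ZP.<-irrefl (sym (trans (ab a b) (trans (cong (λ t → a + t) z) (ZP.+-identityʳ a)))) lt)
  ... | inj₂ (inj₂ p) = ⊥-elim (ZP.<-asym lt (pzLtZ (pzS (ng a b) p)))

  le0 : ∀ {x} → + 0 ℤ.≤ x → NonNeg x
  le0 {+ n} _ = n , refl

  le0' : ∀ {x} → NonNeg x → + 0 ℤ.≤ x
  le0' (n , refl) = ℤ.+≤+ ℕ.z≤n

  private
    m0 : ∀ x → x - + 0 ≡ x
    m0 = solve-∀
    z0 : ∀ x → + 0 - x ≡ - x
    z0 = solve-∀

  lt0 : ∀ {x} → + 0 ℤ.< x → Positive x
  lt0 {x} lt = pzS (m0 x) (ltd lt)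
  lt0' : ∀ {x} → Positive x → + 0 ℤ.< x
  lt0' {x} p = pzLtZ (pzS (sym (m0 x)) p)
  ltn : ∀ {x} → x ℤ.< + 0 → Positive (- x)
  ltn {x} lt = pzS (z0 x) (ltd lt)
  ltn' : ∀ {x} → Positive (- x) → x ℤ.< + 0
  ltn' {x} p = pzLtZ (pzS (sym (z0 x)) p)

open IntegerOrder

-- An element (a, b) = a + bω has integer coordinates
-- (x, y) with T₀(a + bω) = x + y√D; positivity of elements is positivity of
-- x + y√D.
-- The predicate P and conjugation are kept abstract so that the definitions
-- of Defs are unfolded only here.
module Positivity (D : ℕ) (D≥2 : 2 ℕ.≤ D) (sf : SquareFree D) where
  open ConvergentSigns D D≥2 sf public

  ps⇒pr : ∀ {x y} → PosSqrt D x y → PosSurd x y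
  ps⇒pr (inj₁ (a , b , c)) = inj₁ (le0 a , le0 b , c)
  ps⇒pr {x} {y} (inj₂ (inj₁ (a , b , c))) = inj₂ (inj₁ (lt0 a , ltn b , ltd c))
  ps⇒pr {x} {y} (inj₂ (inj₂ (a , b , c))) = inj₂ (inj₂ (ltn a , lt0 b , ltd c))

  pr⇒ps : ∀ {x y} → PosSurd x y → PosSqrt D x y
  pr⇒ps (inj₁ (a , b , c)) = inj₁ (le0' a , le0' b , c)
  pr⇒ps (inj₂ (inj₁ (a , b , c))) = inj₂ (inj₁ (lt0' a , ltn' b , pzLtZ c))
  pr⇒ps (inj₂ (inj₂ (a , b , c))) = inj₂ (inj₂ (ltn' a , lt0' b , pzLtZ c))

  coords : Bool → OK → ℤ × ℤ
  coords true (a , b) = (+ 2 * a + b , b)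
  coords false (a , b) = (a , b)

  PosCoords : Bool → OK → Set
  PosCoords c z = PosSurd (proj₁ (coords c z)) (proj₂ (coords c z))

  pos-to-coords : ∀ c (a b : ℤ) → (if c then PosSqrt D (+ 2 * a + b) b else PosSqrt D a b) → PosCoords c (a , b)
  pos-to-coords true a b h = ps⇒pr h
  pos-to-coords false a b h = ps⇒pr h

  coords-to-pos : ∀ c (a b : ℤ) → PosCoords c (a , b) → (if c then PosSqrt D (+ 2 * a + b) b else PosSqrt D a b)
  coords-to-pos true a b h = pr⇒ps h
  coords-to-pos false a b h = pr⇒ps h

  okq : ∀ {a b c d : ℤ} → a ≡ c → b ≡ d → (a , b) ≡ (c , d)
  okq = cong₂ _,_

  is1mod4 : Bool
  is1mod4 = oneMod4 D

  zeroOK : OK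
  zeroOK = (+ 0 , + 0)

  negOK : OK → OK
  negOK (a , b) = (- a , - b)

  coords-⊕ : ∀ c z w → coords c (z ⊕ w) ≡ (proj₁ (coords c z) + proj₁ (coords c w) , proj₂ (coords c z) + proj₂ (coords c w))
  coords-⊕ true (a , b) (c , d) = cong (_, b + d) (lem a b c d)
    where lem : ∀ a b c d → + 2 * (a + c) + (b + d) ≡ (+ 2 * a + b) + (+ 2 * c + d)
          lem = solve-∀
  coords-⊕ false (a , b) (c , d) = refl

  coords-neg : ∀ c z → coords c (negOK z) ≡ (- proj₁ (coords c z) , - proj₂ (coords c z))
  coords-neg true (a , b) = cong (_, - b) (lem a b)
    where lem : ∀ a b → + 2 * (- a) + (- b) ≡ - (+ 2 * a + b)
          lem = solve-∀
  coords-neg false (a , b) = refl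

  coords-zero : ∀ c z → proj₁ (coords c z) ≡ + 0 → proj₂ (coords c z) ≡ + 0 → z ≡ zeroOK
  coords-zero true (a , b) e1 e2 = cong₂ _,_ (a0 (trans (cong (λ t → + 2 * a + t) (sym e2)) e1)) e2
    where
      a0 : + 2 * a + + 0 ≡ + 0 → a ≡ + 0
      a0 e with trichotomy a
      ... | inj₁ p = ⊥-elim (pz≢0 (pzS (lem a) (pz* (1 , refl) p)) e)
        where lem : ∀ a → + 2 * a ≡ + 2 * a + + 0
              lem = solve-∀
      ... | inj₂ (inj₁ z) = z
      ... | inj₂ (inj₂ p) = ⊥-elim (pz≢0 (pzS (lem a) (pz* (1 , refl) p)) (cong -_ e))
        where lem : ∀ a → + 2 * (- a) ≡ - (+ 2 * a + + 0)
              lem = solve-∀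
  coords-zero false (a , b) e1 e2 = cong₂ _,_ e1 e2

  conjIf : Bool → OK → OK
  conjIf c (a , b) = if c then (a + b , - b) else (a , - b)

  cj-add' : ∀ c z w → conjIf c (z ⊕ w) ≡ conjIf c z ⊕ conjIf c w
  cj-add' true (a , b) (x , y) = okq (lem a b x y) (lem2 b y)
    where lem : ∀ a b x y → a + x + (b + y) ≡ a + b + (x + y)
          lem = solve-∀
          lem2 : ∀ b y → - (b + y) ≡ - b + - y
          lem2 = solve-∀
  cj-add' false (a , b) (x , y) = okq refl (lem2 b y)
    where lem2 : ∀ b y → - (b + y) ≡ - b + - y
          lem2 = solve-∀
  cj-sc' : ∀ c k z → conjIf c (k · z) ≡ k · conjIf c z
  cj-sc' true k (a , b) = okq (lem k a b) (lem2 k b)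
    where lem : ∀ k a b → k * a + k * b ≡ k * (a + b)
          lem = solve-∀
          lem2 : ∀ k b → - (k * b) ≡ k * - b
          lem2 = solve-∀
  cj-sc' false k (a , b) = okq refl (lem2 k b)
    where lem2 : ∀ k b → - (k * b) ≡ k * - b
          lem2 = solve-∀
  cj-inv' : ∀ c z → conjIf c (conjIf c z) ≡ z
  cj-inv' true (a , b) = okq (lem a b) (ZP.neg-involutive b)
    where lem : ∀ a b → a + b + - b ≡ a
          lem = solve-∀
  cj-inv' false (a , b) = okq refl (ZP.neg-involutive b)
  cj-sub' : ∀ c z w → conjIf c (z ⊖ w) ≡ conjIf c z ⊖ conjIf c w
  cj-sub' true (a , b) (x , y) = okq (lem a b x y) (lem2 b y)
    where lem : ∀ a b x y → a - x + (b - y) ≡ a + b - (x + y)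
          lem = solve-∀
          lem2 : ∀ b y → - (b - y) ≡ - b - - y
          lem2 = solve-∀
  cj-sub' false (a , b) (x , y) = okq refl (lem2 b y)
    where lem2 : ∀ b y → - (b - y) ≡ - b - - y
          lem2 = solve-∀
  cj-one' : ∀ c → conjIf c one ≡ one
  cj-one' true = refl
  cj-one' false = refl
  coords-cj' : ∀ c z → coords c (conjIf c z) ≡ (proj₁ (coords c z) , - proj₂ (coords c z))
  coords-cj' true (a , b) = okq (lem a b) refl
    where lem : ∀ a b → + 2 * (a + b) + - b ≡ + 2 * a + b
          lem = solve-∀
  coords-cj' false (a , b) = refl

  abstract
    P : OK → Set
    P z = Pos D z

    toCoords : ∀ {z} → P z → PosCoords is1mod4 z
    toCoords {a , b} h = pos-to-coords is1mod4 a b h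
    fromCoords : ∀ {z} → PosCoords is1mod4 z → P z
    fromCoords {a , b} h = coords-to-pos is1mod4 a b h

    P-in : ∀ {z} → Pos D z → P z
    P-in h = h
    P-out : ∀ {z} → P z → Pos D z
    P-out h = h

    Pos-add : ∀ {z w} → P z → P w → P (z ⊕ w)
    Pos-add {z} {w} h1 h2 = fromCoords (subst (λ p → PosSurd (proj₁ p) (proj₂ p)) (sym (coords-⊕ is1mod4 z w)) (pr-add (toCoords h1) (toCoords h2)))

    Pos-asym : ∀ {z} → P z → P (negOK z) → ⊥
    Pos-asym {z} h1 h2 = pr-asym (toCoords h1) (subst (λ p → PosSurd (proj₁ p) (proj₂ p)) (coords-neg is1mod4 z) (toCoords {negOK z} h2))

    Pos-tri : ∀ z → P z ⊎ (z ≡ zeroOK ⊎ P (negOK z))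
    Pos-tri z with pr-tri (proj₁ (coords is1mod4 z)) (proj₂ (coords is1mod4 z))
    ... | inj₁ h = inj₁ (fromCoords h)
    ... | inj₂ (inj₁ (e1 , e2)) = inj₂ (inj₁ (coords-zero is1mod4 z e1 e2))
    ... | inj₂ (inj₂ h) = inj₂ (inj₂ (fromCoords (subst (λ p → PosSurd (proj₁ p) (proj₂ p)) (sym (coords-neg is1mod4 z)) h)))

    cj : OK → OK
    cj = conj D

    cj-def : ∀ z → cj z ≡ conj D z
    cj-def z = refl

    coords-cj : ∀ z → coords is1mod4 (cj z) ≡ (proj₁ (coords is1mod4 z) , - proj₂ (coords is1mod4 z))
    coords-cj = coords-cj' is1mod4

    cj-add : ∀ z w → cj (z ⊕ w) ≡ cj z ⊕ cj w
    cj-add = cj-add' is1mod4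

    cj-sc : ∀ k z → cj (k · z) ≡ k · cj z
    cj-sc = cj-sc' is1mod4

    cj-inv : ∀ z → cj (cj z) ≡ z
    cj-inv = cj-inv' is1mod4

    cj-sub : ∀ z w → cj (z ⊖ w) ≡ cj z ⊖ cj w
    cj-sub = cj-sub' is1mod4

    cj-one : cj one ≡ one
    cj-one = cj-one' is1mod4

  cj-inj : ∀ {z w} → cj z ≡ cj w → z ≡ w
  cj-inj {z} {w} e = trans (sym (cj-inv z)) (trans (cong cj e) (cj-inv w))

  NonNegP : OK → Set
  NonNegP z = P z ⊎ z ≡ zeroOK

  P-zero : P zeroOK → ⊥
  P-zero h = Pos-asym {zeroOK} h h

  PS : ∀ {z w} → z ≡ w → P z → P w
  PS = subst P

  P+N : ∀ {z w} → P z → NonNegP w → P (z ⊕ w)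
  P+N h (inj₁ h') = Pos-add h h'
  P+N {z} h (inj₂ refl) = PS (sym (lem z)) h
    where lem : ∀ z → z ⊕ zeroOK ≡ z
          lem (a , b) = okq (ZP.+-identityʳ a) (ZP.+-identityʳ b)

  N+P : ∀ {z w} → NonNegP z → P w → P (z ⊕ w)
  N+P {z} {w} h h' = PS (comm w z) (P+N h' h)
    where comm : ∀ z w → z ⊕ w ≡ w ⊕ z
          comm (a , b) (c , d) = okq (ZP.+-comm a c) (ZP.+-comm b d)

  N+N : ∀ {z w} → NonNegP z → NonNegP w → NonNegP (z ⊕ w)
  N+N (inj₁ h) h' = inj₁ (P+N h h')
  N+N {z} {w} (inj₂ refl) (inj₁ h') = inj₁ (N+P (inj₂ refl) h')
  N+N (inj₂ refl) (inj₂ refl) = inj₂ refl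

  scP : ∀ n {z} → P z → P ((+ suc n) · z)
  scP zero {a , b} h = PS (okq (sym (ZP.*-identityˡ a)) (sym (ZP.*-identityˡ b))) h
  scP (suc n) {a , b} h = PS (okq (lem (+ suc n) a) (lem (+ suc n) b)) (Pos-add h (scP n h))
    where lem : ∀ k a → a + k * a ≡ (+ 1 + k) * a
          lem = solve-∀

  scN : ∀ n {z} → P z → NonNegP ((+ n) · z)
  scN zero {a , b} h = inj₂ (okq (ZP.*-zeroˡ a) (ZP.*-zeroˡ b))
  scN (suc n) h = inj₁ (scP n h)

  scNN : ∀ {k z} → NonNeg k → P z → NonNegP (k · z)
  scNN (n , refl) h = scN n h

  scPZ : ∀ {k z} → Positive k → P z → P (k · z)
  scPZ (n , refl) h = scP n h

  sgnP : ∀ {k z} → P z → P (k · z) → Positive k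
  sgnP {k} {a , b} h h' with trichotomy k
  ... | inj₁ p = p
  ... | inj₂ (inj₁ refl) = ⊥-elim (P-zero (PS (okq (ZP.*-zeroˡ a) (ZP.*-zeroˡ b)) h'))
  ... | inj₂ (inj₂ p) = ⊥-elim (Pos-asym h' (PS (okq (lem k a) (lem k b)) (scPZ p h)))
    where lem : ∀ k a → (- k) * a ≡ - (k * a)
          lem = solve-∀

module Order (D : ℕ) (D≥2 : 2 ℕ.≤ D) (sf : SquareFree D) where
  open Positivity D D≥2 sf public

  _≪_ : OK → OK → Set
  x ≪ y = P (y ⊖ x)

  TP : OK → Set
  TP x = P x × P (cj x)

  Ind : OK → Set
  Ind x = TP x × ¬ (Σ OK λ b → Σ OK λ c → TP b × TP c × x ≡ b ⊕ c)

  Basis : OK → OK → Set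
  Basis g h = ∀ z → Σ ℤ λ a → Σ ℤ λ b → z ≡ (a · g) ⊕ (b · h)

  private
    r1 : ∀ x y z → (y ⊖ x) ⊕ (z ⊖ y) ≡ z ⊖ x
    r1 (a , b) (c , d) (e , f) = okq (lem a c e) (lem b d f)
      where lem : ∀ a c e → c - a + (e - c) ≡ e - a
            lem = solve-∀
    r2 : ∀ x → x ⊖ x ≡ zeroOK
    r2 (a , b) = okq (ZP.+-inverseʳ a) (ZP.+-inverseʳ b)
    r3 : ∀ x y → negOK (y ⊖ x) ≡ x ⊖ y
    r3 (a , b) (c , d) = okq (lem a c) (lem b d)
      where lem : ∀ a c → - (c - a) ≡ a - c
            lem = solve-∀
    r4 : ∀ x y → y ⊖ x ≡ zeroOK → x ≡ y
    r4 (a , b) (c , d) e = okq (lem a c (cong proj₁ e)) (lem b d (cong proj₂ e))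
      where lem0 : ∀ a c → c ≡ (c - a) + a
            lem0 = solve-∀
            lem : ∀ a c → c - a ≡ + 0 → a ≡ c
            lem a c e = sym (trans (lem0 a c) (trans (cong (_+ a) e) (ZP.+-identityˡ a)))
    r5 : ∀ x y → y ≡ x ⊕ (y ⊖ x)
    r5 (a , b) (c , d) = okq (lem a c) (lem b d)
      where lem : ∀ a c → c ≡ a + (c - a)
            lem = solve-∀

  ≪-trans : ∀ {x y z} → x ≪ y → y ≪ z → x ≪ z
  ≪-trans {x} {y} {z} h1 h2 = PS (r1 x y z) (Pos-add h1 h2)

  ≪-irr : ∀ {x} → x ≪ x → ⊥
  ≪-irr {x} h = P-zero (PS (r2 x) h)

  ≪-tri : ∀ x y → x ≪ y ⊎ (x ≡ y ⊎ y ≪ x)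
  ≪-tri x y with Pos-tri (y ⊖ x)
  ... | inj₁ h = inj₁ h
  ... | inj₂ (inj₁ e) = inj₂ (inj₁ (r4 x y e))
  ... | inj₂ (inj₂ h) = inj₂ (inj₂ (PS (r3 x y) h))

  ≪-asym : ∀ {x y} → x ≪ y → y ≪ x → ⊥
  ≪-asym {x} {y} h1 h2 = ≪-irr {x} (≪-trans {x} {y} {x} h1 h2)

  ≪-≢ : ∀ {x y} → x ≪ y → x ≡ y → ⊥
  ≪-≢ {x} h refl = ≪-irr {x} h

  TP-cj : ∀ {x} → TP x → TP (cj x)
  TP-cj {x} (h1 , h2) = h2 , PS (sym (cj-inv x)) h1

  Ind-cj : ∀ {x} → Ind x → Ind (cj x)
  Ind-cj {x} (tp , nd) = TP-cj tp , λ { (b , c , tb , tc , e) → nd (cj b , cj c , TP-cj tb , TP-cj tc , trans (sym (cj-inv x)) (trans (cong cj e) (cj-add b c))) }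

  -- conjugation reverses the order of indecomposables: if x < y and
  -- x' ≤ y' then y = x + (y - x) would be decomposable
  conj-ord : ∀ {x y} → Ind x → Ind y → x ≪ y → cj y ≪ cj x
  conj-ord {x} {y} ix iy h with ≪-tri (cj x) (cj y)
  ... | inj₁ h' = ⊥-elim (proj₂ iy (x , y ⊖ x , proj₁ ix , (h , PS (sym (cj-sub y x)) h') , r5 x y))
  ... | inj₂ (inj₁ e) = ⊥-elim (≪-≢ h (cj-inj e))
  ... | inj₂ (inj₂ h') = h'

  not-nonPos : ∀ {z} → P z → NonNegP (negOK z) → ⊥
  not-nonPos h (inj₁ h') = Pos-asym h h'
  not-nonPos {a , b} h (inj₂ e) = P-zero (PS (okq (lem a (cong proj₁ e)) (lem b (cong proj₂ e))) h)
    where lem : ∀ a → - a ≡ + 0 → a ≡ + 0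
          lem a e = trans (sym (ZP.neg-involutive a)) (cong -_ e)

  private
    I3a : ∀ g h a b → (h ⊖ ((a · g) ⊕ (b · h))) ⊕ ((- a) · (h ⊖ g)) ≡ (+ 1 - b - a) · h
    I3a (g1 , g2) (h1 , h2) a b = okq (lem g1 h1 a b) (lem g2 h2 a b)
      where lem : ∀ g h a b → h - (a * g + b * h) + (- a) * (h - g) ≡ (+ 1 - b - a) * h
            lem = solve-∀
    I3b : ∀ g h a b → (((a · g) ⊕ (b · h)) ⊖ h) ⊕ ((- a) · (g ⊖ h)) ≡ (b - + 1 + a) · h
    I3b (g1 , g2) (h1 , h2) a b = okq (lem g1 h1 a b) (lem g2 h2 a b)
      where lem : ∀ g h a b → a * g + b * h - h + (- a) * (g - h) ≡ (b - + 1 + a) * h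
            lem = solve-∀
    I4a : ∀ g h a b → (((a · g) ⊕ (b · h)) ⊖ g) ⊕ ((- b) · (h ⊖ g)) ≡ (a - + 1 + b) · g
    I4a (g1 , g2) (h1 , h2) a b = okq (lem g1 h1 a b) (lem g2 h2 a b)
      where lem : ∀ g h a b → a * g + b * h - g + (- b) * (h - g) ≡ (a - + 1 + b) * g
            lem = solve-∀
    I4b : ∀ g h a b → (g ⊖ ((a · g) ⊕ (b · h))) ⊕ ((- b) · (g ⊖ h)) ≡ (+ 1 - a - b) · g
    I4b (g1 , g2) (h1 , h2) a b = okq (lem g1 h1 a b) (lem g2 h2 a b)
      where lem : ∀ g h a b → g - (a * g + b * h) + (- b) * (g - h) ≡ (+ 1 - a - b) * g
            lem = solve-∀
    Id1 : ∀ g h a b → (a · g) ⊕ (b · h) ≡ g ⊕ (((a - + 1) · g) ⊕ (b · h))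
    Id1 (g1 , g2) (h1 , h2) a b = okq (lem g1 h1 a b) (lem g2 h2 a b)
      where lem : ∀ g h a b → a * g + b * h ≡ g + ((a - + 1) * g + b * h)
            lem = solve-∀
    Ing : ∀ g h a b → negOK ((a · g) ⊕ (b · h)) ≡ ((- a) · g) ⊕ ((- b) · h)
    Ing (g1 , g2) (h1 , h2) a b = okq (lem g1 h1 a b) (lem g2 h2 a b)
      where lem : ∀ g h a b → - (a * g + b * h) ≡ (- a) * g + (- b) * h
            lem = solve-∀
    en1 : ∀ a b → b - + 1 + a ≡ - (+ 1 - b - a)
    en1 = solve-∀
    en2 : ∀ a b → + 1 - a - b ≡ - (a - + 1 + b)
    en2 = solve-∀

  cj-lin : ∀ a b g h → cj ((a · g) ⊕ (b · h)) ≡ (a · cj g) ⊕ (b · cj h)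
  cj-lin a b g h = trans (cj-add (a · g) (b · h)) (cong₂ _⊕_ (cj-sc a g) (cj-sc b h))

  -- Separation: write e = ag + bh.  If a, b > 0 then e = g + ((a-1)g + bh)
  -- decomposes; if a, b ≤ 0 then e' ≤ 0.  If a ≤ 0 < b, then h - e > 0
  -- forces 1 - a - b > 0 while e' - h' > 0 forces a + b - 1 > 0; the case
  -- a > 0 ≥ b is symmetric, using e - g > 0 and g' - e' > 0.
  module Separation {g h e : OK} (ig : Ind g) (ih : Ind h) (ie : Ind e)
      (g<h : g ≪ h) (h'<g' : cj h ≪ cj g) (g<e : g ≪ e) (e<h : e ≪ h)
      {a b : ℤ} (ee : e ≡ (a · g) ⊕ (b · h)) where
    private
      e'<g' : cj e ≪ cj g
      e'<g' = conj-ord ig ie g<e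
      h'<e' : cj h ≪ cj e
      h'<e' = conj-ord ie ih e<h
      ce : cj e ≡ (a · cj g) ⊕ (b · cj h)
      ce = trans (cong cj ee) (cj-lin a b g h)
      Pg = proj₁ (proj₁ ig)
      Pg' = proj₂ (proj₁ ig)
      Ph = proj₁ (proj₁ ih)
      Ph' = proj₂ (proj₁ ih)

    both-pos : Positive a → Positive b → ⊥
    both-pos pa pb = proj₂ ie (g , _ , proj₁ ig , (rest , rest') , trans ee (Id1 g h a b))
      where
        rest : P (((a - + 1) · g) ⊕ (b · h))
        rest = N+P (scNN (pz-1 pa) Pg) (scPZ pb Ph)
        rest' : P (cj (((a - + 1) · g) ⊕ (b · h)))
        rest' = PS (sym (cj-lin (a - + 1) b g h)) (N+P (scNN (pz-1 pa) Pg') (scPZ pb Ph'))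

    both-nonPos : NonNeg (- a) → NonNeg (- b) → ⊥
    both-nonPos na nb = not-nonPos (proj₂ (proj₁ ie))
      (subst NonNegP (sym (trans (cong negOK ce) (Ing (cj g) (cj h) a b))) (N+N (scNN na Pg') (scNN nb Ph')))

    nonPos-pos : NonNeg (- a) → Positive b → ⊥
    nonPos-pos na pb = pz-negpz p1 (pzS (en1 a b) p2)
      where
        p1 : Positive (+ 1 - b - a)
        p1 = sgnP Ph (PS (I3a g h a b) (P+N (subst (λ t → P (h ⊖ t)) ee e<h) (scNN na g<h)))
        p2 : Positive (b - + 1 + a)
        p2 = sgnP Ph' (PS (I3b (cj g) (cj h) a b) (P+N (subst (λ t → P (t ⊖ cj h)) ce h'<e') (scNN na h'<g')))

    pos-nonPos : Positive a → NonNeg (- b) → ⊥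
    pos-nonPos pa nb = pz-negpz p1 (pzS (en2 a b) p2)
      where
        p1 : Positive (a - + 1 + b)
        p1 = sgnP Pg (PS (I4a g h a b) (P+N (subst (λ t → P (t ⊖ g)) ee g<e) (scNN nb g<h)))
        p2 : Positive (+ 1 - a - b)
        p2 = sgnP Pg' (PS (I4b (cj g) (cj h) a b) (P+N (subst (λ t → P (cj g ⊖ t)) ce e'<g') (scNN nb h'<g')))

    by-signs : Positive a ⊎ NonNeg (- a) → Positive b ⊎ NonNeg (- b) → ⊥
    by-signs (inj₁ pa) (inj₁ pb) = both-pos pa pb
    by-signs (inj₁ pa) (inj₂ nb) = pos-nonPos pa nb
    by-signs (inj₂ na) (inj₁ pb) = nonPos-pos na pb
    by-signs (inj₂ na) (inj₂ nb) = both-nonPos na nb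

  between : ∀ {g h e} → Ind g → Ind h → Ind e → Basis g h → g ≪ h → cj h ≪ cj g → g ≪ e → e ≪ h → ⊥
  between {g} {h} {e} ig ih ie bs g<h h'<g' g<e e<h =
    Separation.by-signs ig ih ie g<h h'<g' g<e e<h (proj₂ (proj₂ (bs e)))
      (pos⊎nonPos (proj₁ (bs e))) (pos⊎nonPos (proj₁ (proj₂ (bs e))))

  indecomposable-in : ∀ {x} → Indecomposable D x → Ind x
  indecomposable-in {x} ((p1 , p2) , nd) = (P-in p1 , subst P (sym (cj-def x)) (P-in p2)) ,
    λ { (b , c , (b1 , b2) , (c1 , c2) , e) →
        nd (b , c , (P-out b1 , P-out (subst P (cj-def b) b2)) , (P-out c1 , P-out (subst P (cj-def c) c2)) , e) }

  indecomposable-out : ∀ {x} → Ind x → Indecomposable D x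
  indecomposable-out {x} ((p1 , p2) , nd) = (P-out p1 , P-out (subst P (cj-def x) p2)) ,
    λ { (b , c , (b1 , b2) , (c1 , c2) , e) →
        nd (b , c , (P-in b1 , subst P (sym (cj-def b)) (P-in b2)) , (P-in c1 , subst P (sym (cj-def c)) (P-in c2)) , e) }

-- Writing a summand as
-- x = aA + bB, the conjugate inequality forces a ≥ 1 when b > 0 (and
-- symmetrically for the other summand), which leaves no room for a
-- decomposition.
module IndecomposabilityCriterion (D : ℕ) (D≥2 : 2 ℕ.≤ D) (sf : SquareFree D) where
  open Order D D≥2 sf public

  private
    Y1 : ∀ A B a b → A ⊖ ((a · A) ⊕ (b · B)) ≡ ((+ 1 - a) · A) ⊕ ((- b) · B)
    Y1 (a1 , a2) (b1 , b2) a b = okq (lem a1 b1 a b) (lem a2 b2 a b)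
      where lem : ∀ x y a b → x - (a * x + b * y) ≡ (+ 1 - a) * x + (- b) * y
            lem = solve-∀
    Z1 : ∀ A B a b → (((+ 1 - a) · A) ⊕ ((- b) · B)) ⊕ (((a - + 1) · A) ⊕ (b · B)) ≡ zeroOK
    Z1 (a1 , a2) (b1 , b2) a b = okq (lem a1 b1 a b) (lem a2 b2 a b)
      where lem : ∀ x y a b → (+ 1 - a) * x + (- b) * y + ((a - + 1) * x + b * y) ≡ + 0
            lem = solve-∀
    Z2 : ∀ A B a b → ((a · A) ⊕ (b · B)) ⊕ ((((+ 1 - a) - + 1) · A) ⊕ ((- b) · B)) ≡ zeroOK
    Z2 (a1 , a2) (b1 , b2) a b = okq (lem a1 b1 a b) (lem a2 b2 a b)
      where lem : ∀ x y a b → a * x + b * y + ((+ 1 - a - + 1) * x + (- b) * y) ≡ + 0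
            lem = solve-∀
    Z3 : ∀ A B a → (a · A) ⊕ ((+ 0) · B) ≡ a · A
    Z3 (a1 , a2) (b1 , b2) a = okq (lem a1 b1 a) (lem a2 b2 a)
      where lem : ∀ x y a → a * x + + 0 * y ≡ a * x
            lem = solve-∀
    Z4 : ∀ A B a → ((+ 1 - a) · A) ⊕ ((- + 0) · B) ≡ (+ 1 - a) · A
    Z4 (a1 , a2) (b1 , b2) a = okq (lem a1 b1 a) (lem a2 b2 a)
      where lem : ∀ x y a → (+ 1 - a) * x + (- + 0) * y ≡ (+ 1 - a) * x
            lem = solve-∀
    Z5 : ∀ U V c k → ((c · U) ⊕ (k · V)) ⊕ (k · negOK V) ≡ c · U
    Z5 (a1 , a2) (b1 , b2) c k = okq (lem a1 b1 c k) (lem a2 b2 c k)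
      where lem : ∀ x y c k → c * x + k * y + k * (- y) ≡ c * x
            lem = solve-∀
    sub-eq : ∀ A x y → A ≡ x ⊕ y → y ≡ A ⊖ x
    sub-eq _ (a , b) (c , d) refl = okq (lem a c) (lem b d)
      where lem : ∀ a c → c ≡ a + c - a
            lem = solve-∀
    en : ∀ a → + 1 - a ≡ - (a - + 1)
    en = solve-∀

  indLem : ∀ {A B} → TP A → Basis A B → P B → P (negOK (cj B)) → Ind A
  indLem {A} {B} tA bs pB pB' = tA , λ { (x , y , tx , ty , e) → go x y tx ty e }
    where
      core : ∀ {w c k} → P (cj w) → w ≡ (c · A) ⊕ (k · B) → Positive k → Positive c
      core {w} {c} {k} h e pk = sgnP (proj₂ tA) (PS (Z5 (cj A) (cj B) c k)
          (P+N (PS (trans (cong cj e) (cj-lin c k A B)) h) (inj₁ (scPZ pk pB'))))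
      go : ∀ x y → TP x → TP y → A ≡ x ⊕ y → ⊥
      go x y tx ty e with bs x
      ... | a , b , ex = cases (trichotomy b)
        where
          ey : y ≡ ((+ 1 - a) · A) ⊕ ((- b) · B)
          ey = trans (sub-eq A x y e) (trans (cong (A ⊖_) ex) (Y1 A B a b))
          cases : Positive b ⊎ (b ≡ + 0 ⊎ Positive (- b)) → ⊥
          cases (inj₁ pb) = P-zero (PS (Z1 A B a b) (P+N (PS ey (proj₁ ty)) (inj₁ (N+P (scNN (pz-1 pa) (proj₁ tA)) (scPZ pb pB)))))
            where pa = core {x} {a} {b} (proj₂ tx) ex pb
          cases (inj₂ (inj₁ refl)) = nn-negpz (pz-1 pa') (pzS (en a) p1a)
            where
              pa' : Positive a
              pa' = sgnP (proj₁ tA) (PS (trans ex (Z3 A B a)) (proj₁ tx))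
              p1a : Positive (+ 1 - a)
              p1a = sgnP (proj₁ tA) (PS (trans ey (Z4 A B a)) (proj₁ ty))
          cases (inj₂ (inj₂ pb)) = P-zero (PS (Z2 A B a b) (P+N (PS ex (proj₁ tx)) (inj₁ (N+P (scNN (pz-1 p1a) (proj₁ tA)) (scPZ pb pB)))))
            where p1a = core {y} {+ 1 - a} { - b} (proj₂ ty) ey pb

module Enumeration (D : ℕ) (D≥2 : 2 ℕ.≤ D) (sf : SquareFree D) where
  open IndecomposabilityCriterion D D≥2 sf public

  -- determinant ±1 gives a basis (Cramer's rule)
  basis-det : ∀ {g h} → (proj₁ g * proj₂ h - proj₂ g * proj₁ h) * (proj₁ g * proj₂ h - proj₂ g * proj₁ h) ≡ + 1 → Basis g h
  basis-det {g1 , g2} {h1 , h2} e (z1 , z2) =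
    (z1 * h2 - z2 * h1) * dt , (g1 * z2 - g2 * z1) * dt ,
    sym (trans (okq (lem g1 g2 h1 h2 z1 z2) (lem2 g1 g2 h1 h2 z1 z2)) (okq (trans (cong (λ t → z1 * t) e) (ZP.*-identityʳ z1)) (trans (cong (λ t → z2 * t) e) (ZP.*-identityʳ z2))))
    where
      dt = g1 * h2 - g2 * h1
      lem : ∀ g1 g2 h1 h2 z1 z2 → (z1 * h2 - z2 * h1) * (g1 * h2 - g2 * h1) * g1 + (g1 * z2 - g2 * z1) * (g1 * h2 - g2 * h1) * h1
          ≡ z1 * ((g1 * h2 - g2 * h1) * (g1 * h2 - g2 * h1))
      lem = solve-∀
      lem2 : ∀ g1 g2 h1 h2 z1 z2 → (z1 * h2 - z2 * h1) * (g1 * h2 - g2 * h1) * g2 + (g1 * z2 - g2 * z1) * (g1 * h2 - g2 * h1) * h2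
          ≡ z2 * ((g1 * h2 - g2 * h1) * (g1 * h2 - g2 * h1))
      lem2 = solve-∀

  basis-shift : ∀ {g h} → Basis g h → ∀ k → Basis (g ⊕ (k · h)) h
  basis-shift {g} {h} bs k z with bs z
  ... | a , b , e = a , b - a * k , trans e (lem g h a b k)
    where lem : ∀ g h a b k → (a · g) ⊕ (b · h) ≡ (a · (g ⊕ (k · h))) ⊕ ((b - a * k) · h)
          lem (g1 , g2) (h1 , h2) a b k = okq (l g1 h1 a b k) (l g2 h2 a b k)
            where l : ∀ g h a b k → a * g + b * h ≡ a * (g + k * h) + (b - a * k) * h
                  l = solve-∀

  basis-add2 : ∀ {g h} → Basis g h → Basis g (g ⊕ h)
  basis-add2 {g} {h} bs z with bs z
  ... | a , b , e = a - b , b , trans e (lem g h a b)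
    where lem : ∀ g h a b → (a · g) ⊕ (b · h) ≡ ((a - b) · g) ⊕ (b · (g ⊕ h))
          lem (g1 , g2) (h1 , h2) a b = okq (l g1 h1 a b) (l g2 h2 a b)
            where l : ∀ g h a b → a * g + b * h ≡ (a - b) * g + b * (g + h)
                  l = solve-∀

  basis-cj : ∀ {g h} → Basis g h → Basis (cj h) (cj g)
  basis-cj {g} {h} bs z = b , a , eq
    where
      a = proj₁ (bs (cj z))
      b = proj₁ (proj₂ (bs (cj z)))
      e : cj z ≡ (a · g) ⊕ (b · h)
      e = proj₂ (proj₂ (bs (cj z)))
      comm : ∀ z w → z ⊕ w ≡ w ⊕ z
      comm (a , b) (c , d) = okq (ZP.+-comm a c) (ZP.+-comm b d)
      eq : z ≡ (b · cj h) ⊕ (a · cj g)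
      eq = trans (sym (cj-inv z)) (trans (cong cj e) (trans (cj-lin a b g h) (comm (a · cj g) (b · cj h))))

  record Pair (g h : OK) : Set where
    field
      pg : Ind g
      ph : Ind h
      pb : Basis g h
      plt : g ≪ h
      pclt : cj h ≪ cj g
  open Pair public

  pair-cj : ∀ {g h} → Pair g h → Pair (cj h) (cj g)
  pair-cj {g} {h} p = record { pg = Ind-cj (ph p) ; ph = Ind-cj (pg p) ; pb = basis-cj (pb p) ;
    plt = pclt p ; pclt = subst₂ _≪_ (sym (cj-inv g)) (sym (cj-inv h)) (plt p) }

  private
    pzx1 : ∀ {x} → Positive (x + + 1) → NonNeg x
    pzx1 {x} (k , e) = k , trans (lem x) (trans (cong (_- + 1) e) (lem2 k))
      where lem : ∀ x → x ≡ x + + 1 - + 1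
            lem = solve-∀
            lem2 : ∀ k → + suc k - + 1 ≡ + k
            lem2 k = trans (cong (_- + 1) (cong +_ (NP.+-comm 1 k))) (lem3 (+ k))
              where lem3 : ∀ x → x + + 1 - + 1 ≡ x
                    lem3 = solve-∀
    dl : ∀ a b → b ≡ a + (b - a)
    dl = solve-∀
    dz : ∀ {a b} → b - a ≡ + 0 → b ≡ a
    dz {a} {b} e = trans (dl a b) (trans (cong (λ t → a + t) e) (ZP.+-identityʳ a))

  module Seq (β : ℤ → OK) (mono : ∀ j → β j ≪ β (ℤ.suc j)) (indβ : ∀ j → Ind (β j))
             (surj : ∀ α → Ind α → Σ ℤ λ j → β j ≡ α) where

    β-mono+ : ∀ j k → β j ≪ β (j + + suc k)
    β-mono+ j zero = subst (λ t → β j ≪ β t) (ZP.+-comm (+ 1) j) (mono j)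
    β-mono+ j (suc k) = ≪-trans {β j} {β (j + + suc k)} {β (j + + suc (suc k))} (β-mono+ j k) (subst (λ t → β (j + + suc k) ≪ β t) (lem j (+ suc k)) (mono (j + + suc k)))
      where lem : ∀ j x → + 1 + (j + x) ≡ j + (+ 1 + x)
            lem = solve-∀

    β-mono : ∀ i j → Positive (j - i) → β i ≪ β j
    β-mono i j (k , e) = subst (λ t → β i ≪ β t) (sym (trans (dl i j) (cong (λ t → i + t) e))) (β-mono+ i k)

    private
      e1 : ∀ m n → - (m - (+ 1 + n)) ≡ (n - m) + + 1
      e1 = solve-∀
      e2 : ∀ m n → - ((-[1+ 0 ] + n) - m) ≡ (m - n) + + 1
      e2 m n = lem m n
        where lem : ∀ m n → - ((-[1+ 0 ] + n) - m) ≡ (m - n) + + 1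
              lem = solve-∀

    next-is-least : ∀ n z → Ind z → β n ≪ z → β (ℤ.suc n) ≡ z ⊎ β (ℤ.suc n) ≪ z
    next-is-least n z iz h with surj z iz
    ... | m , refl with trichotomy (m - ℤ.suc n)
    ...   | inj₁ p = inj₂ (β-mono (ℤ.suc n) m p)
    ...   | inj₂ (inj₁ e) = inj₁ (cong β (sym (dz e)))
    ...   | inj₂ (inj₂ p) with trichotomy (n - m)
    ...     | inj₁ q = ⊥-elim (≪-asym {β n} h (β-mono m n q))
    ...     | inj₂ (inj₁ e) = ⊥-elim (≪-irr {β n} (subst (λ t → β n ≪ β t) (sym (dz e)) h))
    ...     | inj₂ (inj₂ q) = ⊥-elim (nn-negpz (pzx1 (pzS (e1 m n) p)) q)

    prev-is-greatest : ∀ n z → Ind z → z ≪ β n → β (ℤ.pred n) ≡ z ⊎ z ≪ β (ℤ.pred n)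
    prev-is-greatest n z iz h with surj z iz
    ... | m , refl with trichotomy (ℤ.pred n - m)
    ...   | inj₁ p = inj₂ (β-mono m (ℤ.pred n) p)
    ...   | inj₂ (inj₁ e) = inj₁ (cong β (dz e))
    ...   | inj₂ (inj₂ p) with trichotomy (m - n)
    ...     | inj₁ q = ⊥-elim (≪-asym {β m} h (β-mono n m q))
    ...     | inj₂ (inj₁ e) = ⊥-elim (≪-irr {β n} (subst (λ t → β t ≪ β n) (dz e) h))
    ...     | inj₂ (inj₂ q) = ⊥-elim (nn-negpz (pzx1 (pzS (e2 m n) p)) q)

    sucpred : ∀ m → ℤ.suc (ℤ.pred m) ≡ m
    sucpred m = lem m
      where lem : ∀ m → + 1 + (-[1+ 0 ] + m) ≡ m
            lem = solve-∀

    -- by 'between', the partner of a Pair is the neighbour in β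
    localNext : ∀ m {g h} → β m ≡ g → Pair g h → β (ℤ.suc m) ≡ h
    localNext m {g} {h} e p with next-is-least m h (ph p) (subst (_≪ h) (sym e) (plt p))
    ... | inj₁ x = x
    ... | inj₂ x = ⊥-elim (between (pg p) (ph p) (indβ (ℤ.suc m)) (pb p) (plt p) (pclt p) (subst (_≪ β (ℤ.suc m)) e (mono m)) x)

    localPrev : ∀ m {g h} → β m ≡ h → Pair g h → β (ℤ.pred m) ≡ g
    localPrev m {g} {h} e p with prev-is-greatest m g (pg p) (subst (g ≪_) (sym e) (plt p))
    ... | inj₁ x = x
    ... | inj₂ x = ⊥-elim (between (pg p) (ph p) (indβ (ℤ.pred m)) (pb p) (plt p) (pclt p) x
                     (subst (β (ℤ.pred m) ≪_) e (subst (λ t → β (ℤ.pred m) ≪ β t) (sucpred m) (mono (ℤ.pred m)))))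

    private
      pr1 : ∀ m → ℤ.pred (- + m) ≡ -[1+ m ]
      pr1 zero = refl
      pr1 (suc m) = refl
      sc1 : ∀ m → ℤ.suc -[1+ m ] ≡ - + m
      sc1 zero = refl
      sc1 (suc m) = refl

    -- β (-m) = β m', by induction on m: β (-(m+1)) and β (m+1)' are both
    -- the greatest indecomposable below β (-m) = β m'
    reflection : β (+ 0) ≡ one → ∀ m → β (- + m) ≡ cj (β (+ m))
    reflection e0 zero = trans e0 (trans (sym cj-one) (cong cj (sym e0)))
    reflection e0 (suc m) = fin (prev-is-greatest (- + m) b (Ind-cj (indβ (+ suc m))) bl) (next-is-least (+ m) (cj a) (Ind-cj (indβ -[1+ m ])) al)
      where
        IH = reflection e0 m
        a = β -[1+ m ]
        b = cj (β (+ suc m))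
        bl : b ≪ β (- + m)
        bl = subst (b ≪_) (sym IH) (conj-ord (indβ (+ m)) (indβ (+ suc m)) (mono (+ m)))
        a< : a ≪ β (- + m)
        a< = subst (λ t → a ≪ β t) (sc1 m) (mono -[1+ m ])
        al : β (+ m) ≪ cj a
        al = subst (_≪ cj a) (trans (cong cj IH) (cj-inv (β (+ m)))) (conj-ord (indβ -[1+ m ]) (indβ (- + m)) a<)
        fin : β (ℤ.pred (- + m)) ≡ b ⊎ b ≪ β (ℤ.pred (- + m)) → β (ℤ.suc (+ m)) ≡ cj a ⊎ β (ℤ.suc (+ m)) ≪ cj a → β (- + suc m) ≡ b
        fin (inj₁ x) _ = trans (cong β (sym (pr1 m))) x
        fin (inj₂ x) (inj₁ y) = ⊥-elim (≪-≢ {b} x' (trans (cong cj y) (cj-inv a)))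
          where x' : b ≪ a
                x' = subst (λ t → b ≪ β t) (pr1 m) x
        fin (inj₂ x) (inj₂ y) = ⊥-elim (≪-asym {b} x' a<b)
          where
            c1 : cj (cj a) ≪ b
            c1 = conj-ord {β (ℤ.suc (+ m))} {cj a} (indβ (+ suc m)) (Ind-cj (indβ -[1+ m ])) y
            a<b : a ≪ b
            a<b = subst (_≪ b) (cj-inv a) c1
            x' : b ≪ a
            x' = subst (λ t → b ≪ β t) (pr1 m) x

module AlphaFacts (D : ℕ) (D≥2 : 2 ℕ.≤ D) (sf : SquareFree D) where
  open Enumeration D D≥2 sf public

  -- p - qω' in coordinates a + bω (as in Defs.alpha)
  fromPQ : Bool → ℤ → ℤ → OK
  fromPQ b p q = if b then (p - q , q) else (p , q)

  T₀≡ : Bn 0 ≡ (if is1mod4 then + 2 else + 1)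
  T₀≡ = by-residue (oneMod4 D) refl
    where
      by-residue : ∀ b → oneMod4 D ≡ b → Bn 0 ≡ (if is1mod4 then + 2 else + 1)
      by-residue true eq = trans (cong (λ p → + proj₂ p) (start-T eq)) (cong (λ c → if c then + 2 else + 1) (sym eq))
      by-residue false eq = trans (cong (λ p → + proj₂ p) (start-F eq)) (cong (λ c → if c then + 2 else + 1) (sym eq))

  private
    linfb : ∀ b T p q → T ≡ (if b then + 2 else + 1) → coords b (fromPQ b p q) ≡ (T * p - (T - + 1) * q , q)
    linfb true T p q refl = okq (lem p q) refl
      where lem : ∀ p q → + 2 * (p - q) + q ≡ + 2 * p - (+ 2 - + 1) * q
            lem = solve-∀
    linfb false T p q refl = okq (lem p q) refl
      where lem : ∀ p q → p ≡ + 1 * p - (+ 1 - + 1) * q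
            lem = solve-∀

  coords-α : ∀ n → coords is1mod4 (alpha D n) ≡ (X n , Qn n)
  coords-α n = linfb is1mod4 T₀ (Pn n) (Qn n) T₀≡

  pos-from-coords : ∀ {z x y} → coords is1mod4 z ≡ (x , y) → PosSurd x y → P z
  pos-from-coords {z} e h = fromCoords (subst (λ p → PosSurd (proj₁ p) (proj₂ p)) (sym e) h)

  Pα : ∀ n → P (alpha D n)
  Pα n = pos-from-coords (coords-α n) (α-pos n)

  Pcα : ∀ k → P (cj (alpha D (2 ℕ.* k)))
  Pcα k = pos-from-coords (trans (coords-cj (alpha D (2 ℕ.* k))) (cong (λ p → (proj₁ p , - proj₂ p)) (coords-α (2 ℕ.* k)))) (conj-α-even-pos k)

  Pncα : ∀ k → P (negOK (cj (alpha D (suc (2 ℕ.* k)))))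
  Pncα k = pos-from-coords (trans (coords-neg is1mod4 (cj α)) (trans (cong (λ p → (- proj₁ p , - proj₂ p)) (trans (coords-cj α) (cong (λ p → (proj₁ p , - proj₂ p)) (coords-α n)))) (okq refl (ZP.neg-involutive (Qn n))))) (conj-α-odd-neg k)
    where n = suc (2 ℕ.* k)
          α = alpha D n

  private
    recfb : ∀ b P2 Q2 P1 Q1 P0 Q0 U → P2 ≡ U * P1 + P0 → Q2 ≡ U * Q1 + Q0 → fromPQ b P2 Q2 ≡ fromPQ b P0 Q0 ⊕ (U · fromPQ b P1 Q1)
    recfb true P2 Q2 P1 Q1 P0 Q0 U refl refl = okq (lem P1 Q1 P0 Q0 U) (ZP.+-comm (U * Q1) Q0)
      where lem : ∀ P1 Q1 P0 Q0 U → U * P1 + P0 - (U * Q1 + Q0) ≡ P0 - Q0 + U * (P1 - Q1)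
            lem = solve-∀
    recfb false P2 Q2 P1 Q1 P0 Q0 U refl refl = okq (ZP.+-comm (U * P1) P0) (ZP.+-comm (U * Q1) Q0)
    detfb : ∀ b P0 Q0 P1 Q1 → proj₁ (fromPQ b P0 Q0) * proj₂ (fromPQ b P1 Q1) - proj₂ (fromPQ b P0 Q0) * proj₁ (fromPQ b P1 Q1) ≡ P0 * Q1 - Q0 * P1
    detfb true P0 Q0 P1 Q1 = lem P0 Q0 P1 Q1
      where lem : ∀ P0 Q0 P1 Q1 → (P0 - Q0) * Q1 - Q0 * (P1 - Q1) ≡ P0 * Q1 - Q0 * P1
            lem = solve-∀
    detfb false P0 Q0 P1 Q1 = refl

  αrec : ∀ n → alpha D (suc (suc n)) ≡ alpha D n ⊕ (Un (suc n) · alpha D (suc n))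
  αrec n = recfb is1mod4 (Pn (suc (suc n))) (Qn (suc (suc n))) (Pn (suc n)) (Qn (suc n)) (Pn n) (Qn n) (Un (suc n)) (recP n) (recQ n)

  alt² : ∀ n → alt n * alt n ≡ + 1
  alt² zero = refl
  alt² (suc n) = trans (lem (alt n)) (alt² n)
    where lem : ∀ x → (- x) * (- x) ≡ x * x
          lem = solve-∀

  -- consecutive α's form a basis: their determinant is ±1
  basisα : ∀ n → Basis (alpha D n) (alpha D (suc n))
  basisα n = basis-det {alpha D n} {alpha D (suc n)} (trans (cong (λ t → t * t) (trans (detfb is1mod4 (Pn n) (Qn n) (Pn (suc n)) (Qn (suc n))) (determinant (identities n)))) (alt² n))

  module _ (k : ℕ) where
    A B : OK
    A = alpha D (2 ℕ.* k)
    B = alpha D (suc (2 ℕ.* k))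
    U' : ℕ
    U' = u D (suc (2 ℕ.* k))

    A2≡ : alpha D (2 ℕ.* suc k) ≡ A ⊕ ((+ U') · B)
    A2≡ = trans (cong (alpha D) (double-suc k)) (αrec (2 ℕ.* k))

    private
      sucR : ∀ (X Y : OK) r → (X ⊕ ((+ r) · Y)) ⊕ Y ≡ X ⊕ ((+ suc r) · Y)
      sucR (x1 , x2) (y1 , y2) r = okq (lem x1 y1 (+ r)) (lem x2 y2 (+ r))
        where lem : ∀ x y r → x + r * y + y ≡ x + (+ 1 + r) * y
              lem = solve-∀
      cdiff : ∀ (Z W : OK) → (Z ⊕ W) ⊖ Z ≡ W
      cdiff (z1 , z2) (w1 , w2) = okq (lem z1 w1) (lem z2 w2)
        where lem : ∀ z w → z + w - z ≡ w
              lem = solve-∀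
      cdiff2 : ∀ (Z W : OK) → Z ⊖ (Z ⊕ W) ≡ negOK W
      cdiff2 (z1 , z2) (w1 , w2) = okq (lem z1 w1) (lem z2 w2)
        where lem : ∀ z w → z - (z + w) ≡ - w
              lem = solve-∀
      cjR : ∀ (CA CB : OK) U r → CA ⊕ ((+ r) · CB) ≡ (CA ⊕ ((+ U) · CB)) ⊕ ((+ U - + r) · negOK CB)
      cjR (a1 , a2) (b1 , b2) U r = okq (lem a1 b1 (+ U) (+ r)) (lem a2 b2 (+ U) (+ r))
        where lem : ∀ a b U r → a + r * b ≡ a + U * b + (U - r) * (- b)
              lem = solve-∀

    -- α_{i,r} ≫ 0: α_{i,r}' = α_{i+2}' + (u - r)(-α_{i+1}')
    TPαR : ∀ r → r ℕ.≤ U' → TP (alphaR D k r)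
    TPαR r le = P+N (Pα (2 ℕ.* k)) (scN r (Pα (suc (2 ℕ.* k)))) ,
       PS (sym (trans (cj-add A ((+ r) · B)) (cong (cj A ⊕_) (cj-sc (+ r) B))))
         (PS (sym (cjR (cj A) (cj B) U' r))
           (P+N (PS (trans (cong cj A2≡) (trans (cj-add A _) (cong (cj A ⊕_) (cj-sc (+ U') B)))) (Pcα (suc k)))
                (scNN (leNN le) (Pncα k))))

    -- α_{i,r} is indecomposable by the criterion, with basis (α_{i,r}, α_{i+1})
    IndαR : ∀ r → r ℕ.≤ U' → Ind (alphaR D k r)
    IndαR r le = indLem (TPαR r le) (basis-shift (basisα (2 ℕ.* k)) (+ r)) (Pα (suc (2 ℕ.* k))) (Pncα k)

    -- α_{i,r} < α_{i,r+1} = α_{i,r} + α_{i+1} is a Pair since α_{i+1}' < 0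
    pairR : ∀ r → suc r ℕ.≤ U' → Pair (alphaR D k r) (alphaR D k (suc r))
    pairR r le = record
      { pg = IndαR r (NP.<⇒≤ le)
      ; ph = IndαR (suc r) le
      ; pb = subst (Basis (alphaR D k r)) (sucR A B r) (basis-add2 (basis-shift (basisα (2 ℕ.* k)) (+ r)))
      ; plt = PS (sym (trans (cong (_⊖ alphaR D k r) (sym (sucR A B r))) (cdiff (alphaR D k r) B))) (Pα (suc (2 ℕ.* k)))
      ; pclt = PS (sym (trans (cong (λ t → cj (alphaR D k r) ⊖ cj t) (sym (sucR A B r))) (trans (cong (cj (alphaR D k r) ⊖_) (cj-add (alphaR D k r) B)) (cdiff2 (cj (alphaR D k r)) (cj B))))) (Pncα k)
      }

    vertex : alphaR D k U' ≡ alphaR D (suc k) 0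
    vertex = trans (sym A2≡) (lem (alpha D (2 ℕ.* suc k)) (alpha D (suc (2 ℕ.* suc k))))
      where lem : ∀ (X Y : OK) → X ≡ X ⊕ ((+ 0) · Y)
            lem (x1 , x2) (y1 , y2) = okq (lm x1 y1) (lm x2 y2)
              where lm : ∀ x y → x ≡ x + + 0 * y
                    lm = solve-∀

-- Interior points α_{i,r} (1 ≤ r < u) sit between
-- α_{i,r-1} and α_{i,r+1}, whose sum is 2α_{i,r}.  A vertex α_{i,0} sits
-- between α_{i-2,u-1} and α_{i,1} with sum (u_{i+1} + 2)α_{i,0}; at the
-- vertex 1 = α_{-1,0} the left neighbour is α_{-1,1}' and the sum uses the
-- trace α_0 + α_0' = u_0.  Negative indices follow by conjugation.
module Recurrence (D : ℕ) (D≥2 : 2 ℕ.≤ D) (sf : SquareFree D) where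
  open AlphaFacts D D≥2 sf public

  private
    cj≡conjIf : ∀ z → cj z ≡ conjIf is1mod4 z
    cj≡conjIf z = cj-def z
    trace-formula : ∀ b P U → (if b then U ≡ P + P - + 1 else U ≡ P + P) → fromPQ b P (+ 1) ⊕ conjIf b (fromPQ b P (+ 1)) ≡ (U , + 0)
    trace-formula true P U refl = okq (lem P) refl
      where lem : ∀ P → P - + 1 + (P - + 1 + + 1) ≡ P + P - + 1
            lem = solve-∀
    trace-formula false P U refl = okq refl refl
    αR00-coords : ∀ b Z → fromPQ b (+ 1) (+ 0) ⊕ ((+ 0) · Z) ≡ one
    αR00-coords true (z1 , z2) = okq (lem z1) (lem2 z2)
      where lem : ∀ z → + 1 - + 0 + + 0 * z ≡ + 1
            lem = solve-∀
            lem2 : ∀ z → + 0 + + 0 * z ≡ + 0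
            lem2 = solve-∀
    αR00-coords false (z1 , z2) = okq (lem z1) (lem2 z2)
      where lem : ∀ z → + 1 + + 0 * z ≡ + 1
            lem = solve-∀
            lem2 : ∀ z → + 0 + + 0 * z ≡ + 0
            lem2 = solve-∀
    fromPQ-one : ∀ b → fromPQ b (+ 1) (+ 0) ≡ one
    fromPQ-one true = refl
    fromPQ-one false = refl

  -- u_0 = 2p_0 - 1 resp. 2p_0, by the choice p_0 = ⌈u_0/2⌉
  u₀-vs-p₀ : if is1mod4 then (Un 0 ≡ Pn 1 + Pn 1 - + 1) else (Un 0 ≡ Pn 1 + Pn 1)
  u₀-vs-p₀ = by-residue (oneMod4 D) refl
    where
      by-residue : ∀ b → oneMod4 D ≡ b → if is1mod4 then (Un 0 ≡ Pn 1 + Pn 1 - + 1) else (Un 0 ≡ Pn 1 + Pn 1)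
      by-residue true eq = subst (λ c → if c then (Un 0 ≡ Pn 1 + Pn 1 - + 1) else (Un 0 ≡ Pn 1 + Pn 1)) (sym eq)
        (trans (cong +_ (u0-T eq)) (trans (cong (λ z → + 1 + z) (pos-* 2 t)) (trans (lem (+ t)) (cong (λ z → z + z - + 1) (sym (cong +_ (p0-T eq)))))))
        where lem : ∀ t → + 1 + + 2 * t ≡ (+ 1 + t) + (+ 1 + t) - + 1
              lem = solve-∀
      by-residue false eq = subst (λ c → if c then (Un 0 ≡ Pn 1 + Pn 1 - + 1) else (Un 0 ≡ Pn 1 + Pn 1)) (sym eq)
        (trans (cong +_ (u0-F eq)) (cong (λ z → z + z) (sym (cong +_ (p0-F eq)))))

  trace : alpha D 1 ⊕ cj (alpha D 1) ≡ (Un 0 , + 0)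
  trace = trans (cong (alpha D 1 ⊕_) (cj≡conjIf (alpha D 1))) (trace-formula is1mod4 (Pn 1) (Un 0) u₀-vs-p₀)

  αR00 : alphaR D 0 0 ≡ one
  αR00 = αR00-coords is1mod4 (alpha D 1)

  αR01 : alphaR D 0 1 ≡ one ⊕ ((+ 1) · alpha D 1)
  αR01 = cong (_⊕ ((+ 1) · alpha D 1)) (fromPQ-one is1mod4)

  private
    one-sum : ∀ (Z W : OK) U → Z ⊕ W ≡ (U , + 0) → (U + + 2) · one ≡ (one ⊕ ((+ 1) · W)) ⊕ (one ⊕ ((+ 1) · Z))
    one-sum (z1 , z2) (w1 , w2) U e = okq (trans (cong (λ t → (t + + 2) * + 1) (sym (cong proj₁ e))) (lem z1 w1))
                                      (trans (lem2 U) (trans (sym (cong proj₂ e)) (lem3 z2 w2)))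
      where lem : ∀ z w → (z + w + + 2) * + 1 ≡ + 1 + + 1 * w + (+ 1 + + 1 * z)
            lem = solve-∀
            lem2 : ∀ U → (U + + 2) * + 0 ≡ + 0
            lem2 = solve-∀
            lem3 : ∀ z w → z + w ≡ + 0 + + 1 * w + (+ 0 + + 1 * z)
            lem3 = solve-∀
    interior-sum : ∀ (A B : OK) r → (+ 2) · (A ⊕ ((+ 1 + r) · B)) ≡ (A ⊕ (r · B)) ⊕ (A ⊕ ((+ 1 + (+ 1 + r)) · B))
    interior-sum (a1 , a2) (b1 , b2) r = okq (lem a1 b1 r) (lem a2 b2 r)
      where lem : ∀ a b r → + 2 * (a + (+ 1 + r) * b) ≡ a + r * b + (a + (+ 1 + (+ 1 + r)) * b)
            lem = solve-∀
    vertex-sum : ∀ (A0 A1 : OK) U' U'' k1 → k1 ≡ U' - + 1 →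
      (U'' + + 2) · ((A0 ⊕ (U' · A1)) ⊕ ((+ 0) · (A1 ⊕ (U'' · (A0 ⊕ (U' · A1))))))
      ≡ (A0 ⊕ (k1 · A1)) ⊕ ((A0 ⊕ (U' · A1)) ⊕ ((+ 1) · (A1 ⊕ (U'' · (A0 ⊕ (U' · A1))))))
    vertex-sum (a1 , a2) (b1 , b2) U' U'' k1 refl = okq (lem a1 b1 U' U'') (lem a2 b2 U' U'')
      where lem : ∀ a b U' U'' → (U'' + + 2) * ((a + U' * b) + + 0 * (b + U'' * (a + U' * b)))
                    ≡ (a + (U' - + 1) * b) + ((a + U' * b) + + 1 * (b + U'' * (a + U' * b)))
            lem = solve-∀
    vertex-sum' : ∀ (A0 A1 : OK) U' U'' k1 {A2 A3} → k1 ≡ U' - + 1 → A2 ≡ A0 ⊕ (U' · A1) → A3 ≡ A1 ⊕ (U'' · A2) →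
      (U'' + + 2) · (A2 ⊕ ((+ 0) · A3)) ≡ (A0 ⊕ (k1 · A1)) ⊕ (A2 ⊕ ((+ 1) · A3))
    vertex-sum' A0 A1 U' U'' k1 e refl refl = vertex-sum A0 A1 U' U'' k1 e

  uge1 : ∀ n → 1 ℕ.≤ u D n
  uge1 n = pzLt {0} {u D n} (subst Positive (sym (ZP.+-identityʳ (Un n))) (uPos n))

  module Main (β : ℤ → OK) (mono : ∀ j → β j ≪ β (ℤ.suc j)) (indβ : ∀ j → Ind (β j))
              (surj : ∀ α → Ind α → Σ ℤ λ j → β j ≡ α) (β0 : β (+ 0) ≡ one) where
    open Seq β mono indβ surj

    recurrence-interior : ∀ m k r → 1 ℕ.≤ r → r ℕ.< U' k → β m ≡ alphaR D k r → (+ 2) · β m ≡ β (ℤ.pred m) ⊕ β (ℤ.suc m)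
    recurrence-interior m k (suc r0) _ lt e = trans (cong ((+ 2) ·_) e) (trans (interior-sum (A k) (B k) (+ r0))
        (sym (cong₂ _⊕_ (localPrev m e (pairR k r0 (NP.<⇒≤ lt))) (localNext m e (pairR k (suc r0) lt)))))

    recurrence-vertex : ∀ m k → β m ≡ alphaR D k 0 → (+ (u D (2 ℕ.* k) ℕ.+ 2)) · β m ≡ β (ℤ.pred m) ⊕ β (ℤ.suc m)
    recurrence-vertex m zero e = trans (cong ((Un 0 + + 2) ·_) (trans e αR00))
        (trans (trans (one-sum (alpha D 1) (cj (alpha D 1)) (Un 0) trace) (cong₂ _⊕_ (sym cα) (sym αR01)))
          (sym (cong₂ _⊕_ prv nxt)))
      where
        nxt : β (ℤ.suc m) ≡ alphaR D 0 1
        nxt = localNext m e (pairR 0 0 (uge1 1))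
        cα : cj (alphaR D 0 1) ≡ one ⊕ ((+ 1) · cj (alpha D 1))
        cα = trans (cong cj αR01) (trans (cj-add one _) (cong₂ _⊕_ cj-one (cj-sc (+ 1) (alpha D 1))))
        e' : β m ≡ cj (alphaR D 0 0)
        e' = trans e (trans αR00 (trans (sym cj-one) (cong cj (sym αR00))))
        prv : β (ℤ.pred m) ≡ cj (alphaR D 0 1)
        prv = localPrev m e' (pair-cj (pairR 0 0 (uge1 1)))
    recurrence-vertex m (suc k) e = trans (cong (λ t → (+ t + + 2) · β m) (cong (u D) (double-suc k)))
        (trans (cong ((Un (suc (suc (2 ℕ.* k))) + + 2) ·_) e)
          (trans (vertex-sum' (A k) (B k) (+ U' k) (Un (suc (suc (2 ℕ.* k)))) (+ (U' k ℕ.∸ 1)) (∸-pos (uge1 (suc (2 ℕ.* k)))) (A2≡ k) eA3)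
            (sym (cong₂ _⊕_ prv nxt))))
      where
        eA3 : alpha D (suc (2 ℕ.* suc k)) ≡ B k ⊕ (Un (suc (suc (2 ℕ.* k))) · alpha D (2 ℕ.* suc k))
        eA3 = trans (cong (λ n → alpha D (suc n)) (double-suc k)) (trans (αrec (suc (2 ℕ.* k))) (cong (λ n → B k ⊕ (Un (suc (suc (2 ℕ.* k))) · alpha D n)) (sym (double-suc k))))
        nxt : β (ℤ.suc m) ≡ alphaR D (suc k) 1
        nxt = localNext m e (pairR (suc k) 0 (uge1 (suc (2 ℕ.* suc k))))
        sv : suc (U' k ℕ.∸ 1) ≡ U' k
        sv = NP.m+[n∸m]≡n (uge1 (suc (2 ℕ.* k)))
        e' : β m ≡ alphaR D k (suc (U' k ℕ.∸ 1))
        e' = trans e (trans (sym (vertex k)) (cong (alphaR D k) (sym sv)))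
        prv : β (ℤ.pred m) ≡ alphaR D k (U' k ℕ.∸ 1)
        prv = localPrev m e' (pairR k (U' k ℕ.∸ 1) (NP.≤-reflexive sv))

    private
      suc-neg : ∀ m → ℤ.suc -[1+ m ] ≡ - (+ m)
      suc-neg zero = refl
      suc-neg (suc m) = refl
      ⊕-comm : ∀ (z w : OK) → z ⊕ w ≡ w ⊕ z
      ⊕-comm (a , b) (c , d) = okq (ZP.+-comm a c) (ZP.+-comm b d)

    mirror : ∀ n v → v · β (+ suc n) ≡ β (ℤ.pred (+ suc n)) ⊕ β (ℤ.suc (+ suc n)) →
             v · β -[1+ n ] ≡ β (ℤ.pred -[1+ n ]) ⊕ β (ℤ.suc -[1+ n ])
    mirror n v e = begin
      v · β -[1+ n ]                                      ≡⟨ cong (v ·_) (reflection β0 (suc n)) ⟩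
      v · cj (β (+ suc n))                                ≡⟨ sym (cj-sc v (β (+ suc n))) ⟩
      cj (v · β (+ suc n))                                ≡⟨ cong cj e ⟩
      cj (β (ℤ.pred (+ suc n)) ⊕ β (ℤ.suc (+ suc n)))     ≡⟨ cj-add (β (ℤ.pred (+ suc n))) (β (ℤ.suc (+ suc n))) ⟩
      cj (β (ℤ.pred (+ suc n))) ⊕ cj (β (ℤ.suc (+ suc n))) ≡⟨ ⊕-comm (cj (β (ℤ.pred (+ suc n)))) (cj (β (ℤ.suc (+ suc n)))) ⟩
      cj (β (ℤ.suc (+ suc n))) ⊕ cj (β (ℤ.pred (+ suc n))) ≡⟨ sym (cong₂ _⊕_ (reflection β0 (suc (suc n)))
                                                                  (trans (cong β (suc-neg n)) (reflection β0 n))) ⟩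
      β (ℤ.pred -[1+ n ]) ⊕ β (ℤ.suc -[1+ n ])            ∎
      where open ≡-Reasoning

    interior : ∀ j k r → 1 ℕ.≤ r → r ℕ.< U' k → β (+ ∣ j ∣) ≡ alphaR D k r →
               (+ 2) · β j ≡ β (ℤ.pred j) ⊕ β (ℤ.suc j)
    interior (+ n) k r r≥1 r<u e = recurrence-interior (+ n) k r r≥1 r<u e
    interior -[1+ n ] k r r≥1 r<u e = mirror n (+ 2) (recurrence-interior (+ suc n) k r r≥1 r<u e)

    at-vertex : ∀ j k → β (+ ∣ j ∣) ≡ alphaR D k 0 →
                (+ (u D (2 ℕ.* k) ℕ.+ 2)) · β j ≡ β (ℤ.pred j) ⊕ β (ℤ.suc j)
    at-vertex (+ n) k e = recurrence-vertex (+ n) k e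
    at-vertex -[1+ n ] k e = mirror n (+ (u D (2 ℕ.* k) ℕ.+ 2)) (recurrence-vertex (+ suc n) k e)

lemma3p2 : (D : ℕ) → 2 ℕ.≤ D → SquareFree D →
    (β : ℤ → OK) →
    (∀ j → β j <[ D ] β (ℤ.suc j)) →
    β (+ 0) ≡ one →
    (∀ j → Indecomposable D (β j)) →
    (∀ α → Indecomposable D α → ∃[ j ] β j ≡ α) →
    ∀ (j : ℤ) →
      (∀ (k r : ℕ) → 1 ℕ.≤ r → r ℕ.< u D (ℕ.suc (2 ℕ.* k)) →
         β (+ ∣ j ∣) ≡ alphaR D k r →
         (+ 2) · β j ≡ β (ℤ.pred j) ⊕ β (ℤ.suc j))
      × (∀ (k : ℕ) → β (+ ∣ j ∣) ≡ alphaR D k 0 →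
         (+ (u D (2 ℕ.* k) ℕ.+ 2)) · β j ≡ β (ℤ.pred j) ⊕ β (ℤ.suc j))
lemma3p2 D D≥2 sf β mono β0 ind surj j = interior j , at-vertex j
  where
    open Recurrence D D≥2 sf
    open Main β (λ i → P-in (mono i)) (λ i → indecomposable-in (ind i))
              (λ α i → surj α (indecomposable-out i)) β0
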